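{- Let $n\geq0$ be an integer, let $C_1,C_2\in\mathcal{C}_n$ and $D_1,D_2\in\mathcal{C}_1$, and put $C=C_1^{\nabla2}\mathbin{\nabla}D_1$ and $C'=C_2^{\nabla2}\mathbin{\nabla}D_2$. If $C_1\neq C_2$ or $D_1\neq D_2$, then $C\cap(2^iC')=\varnothing$ and $C'\cap(2^iC)=\varnothing$ for $i=0,1,2$.
   Context: For nonempty finite sets $C=\{c_1,\ldots,c_s\}$, $D$ of positive integers, $C\mathbin{\nabla}D=c_1D\mathbin{\triangle}\cdots\mathbin{\triangle}c_sD$ with $c_iD=\{c_id: d\in D\}$ and $\triangle$ the symmetric difference (equivalently, the set of $m$ for which the number of pairs $(c,d)\in C\times D$ with $cd=m$ is odd); $C\mathbin{\nabla}D=\varnothing$ if $C$ or $D$ is empty. Also $C^{\nabla2}=C\mathbin{\nabla}C$ (which equals $\{c^2:c\in C\}$), $aC=\{ac:c\in C\}$. Let $H_8=\{1,\ldots,8\}$, $H_8^{\nabla0}=\{1\}$, $H_8^{\nabla m}=H_8^{\nabla(m-1)}\mathbin{\nabla}H_8$ for $m\geq1$. For a finite set $T$ of positive integers, its chains are obtained as follows. A chain of type A is a maximal subset of $T$ of the form $\{x,2x,4x,\ldots,2^{\ell-1}x\}$ with $\ell\geq2$ (maximal meaning it is not properly contained in another such subset of $T$). After removing all elements of type A chains from $T$, a chain of type B is a maximal subset of the remaining elements of the form $\{y,4y,16y,\ldots,4^{\ell-1}y\}$ with $\ell\geq2$. After also removing the elements of type B chains, each remaining element $z$ gives a chain $\{z\}$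 of type C. Let $\mathcal{C}_n$ denote the collection of all chains (of types A, B, C) of $T=H_8^{\nabla(2^n-1)}$; in particular $\mathcal{C}_1=\{\{1,2,4,8\},\{3,6\},\{5\},\{7\}\}$. -}

module Defs where

open import Data.Nat using (ℕ; zero; suc; _*_; _^_; _∸_; _≤_; _≡ᵇ_)
open import Data.Bool using (if_then_else_)
open import Data.List using (List; []; _∷_; _++_; map; concatMap; foldr)
open import Data.List.Membership.Propositional using (_∈_)
open import Data.List.Relation.Unary.All using (All)
open import Data.Product using (Σ; ∃; _×_)
open import Data.Sum using (_⊎_)
open import Data.Empty using (⊥)
open import Relation.Nullary using (¬_)
open import Relation.Binary.PropositionalEquality using (_≡_)

-- Finite sets of positive integers are represented by duplicate-free lists.

toggle : ℕ → List ℕ → List ℕ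
toggle x [] = x ∷ []
toggle x (y ∷ ys) = if x ≡ᵇ y then ys else (y ∷ toggle x ys)

oddSet : List ℕ → List ℕ
oddSet = foldr toggle []

-- C ∇ D : the set of m for which the number of pairs (c,d) ∈ C × D
-- with c * d = m is odd (equivalently c₁D △ ⋯ △ c_sD).
infixl 7 _∇_
_∇_ : List ℕ → List ℕ → List ℕ
C ∇ D = oddSet (concatMap (λ c → map (c *_) D) C)

scale : ℕ → List ℕ → List ℕ
scale a C = map (a *_) C

H8 : List ℕ
H8 = 1 ∷ 2 ∷ 3 ∷ 4 ∷ 5 ∷ 6 ∷ 7 ∷ 8 ∷ []

H8pow : ℕ → List ℕ
H8pow zero = 1 ∷ []
H8pow (suc m) = H8pow m ∇ H8

geom : ℕ → ℕ → ℕ → List ℕ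
geom r x zero = []
geom r x (suc ℓ) = x ∷ geom r (r * x) ℓ

_⊆_ : List ℕ → List ℕ → Set
A ⊆ B = ∀ {z} → z ∈ A → z ∈ B

IsMaxGeom : ℕ → (ℕ → Set) → List ℕ → Set
IsMaxGeom r P S =
  Σ ℕ λ x → Σ ℕ λ ℓ → 2 ≤ ℓ × S ≡ geom r x ℓ × All P S ×
   (∀ x' ℓ' → 2 ≤ ℓ' → All P (geom r x' ℓ') → S ⊆ geom r x' ℓ' → geom r x' ℓ' ⊆ S)

module _ (T : List ℕ) where
  InT : ℕ → Set
  InT z = z ∈ T

  IsChainA : List ℕ → Set
  IsChainA = IsMaxGeom 2 InT

  RemA : ℕ → Set
  RemA z = z ∈ T × ¬ (∃ λ S → IsChainA S × z ∈ S)

  IsChainB : List ℕ → Set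
  IsChainB = IsMaxGeom 4 RemA

  RemB : ℕ → Set
  RemB z = RemA z × ¬ (∃ λ S → IsChainB S × z ∈ S)

  IsChainC : List ℕ → Set
  IsChainC S = ∃ λ z → S ≡ z ∷ [] × RemB z

  IsChain : List ℕ → Set
  IsChain S = IsChainA S ⊎ IsChainB S ⊎ IsChainC S

Tn : ℕ → List ℕ
Tn n = H8pow (2 ^ n ∸ 1)

Chain : ℕ → List ℕ → Set
Chain n = IsChain (Tn n)

Disjoint : List ℕ → List ℕ → Set
Disjoint A B = ∀ {m} → m ∈ A → m ∈ B → ⊥

-- Every element of (C ∇ C) ∇ D is c² d with c ∈ C and d ∈ D, because modulo 2 the square of a
-- set is the set of its squares. The chains of T₁ = H₈ are {1,2,4,8}, {3,6}, {5}, {7}, so d = 2ᵉ p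
-- with e ≤ 3 and an odd p ∈ {1,3,5,7} that determines D. In c₁² 2^{e₁} p₁ = 2ⁱ c₂² 2^{e₂} p₂ the
-- larger of p₁, p₂ would be a prime dividing the two sides to exponents of different parity, so
-- p₁ = p₂, and then c₁ = 2ʲ c₂ or c₂ = 2ʲ c₁ with 2j ≤ 5. Hence it suffices that the chains of Tₙ
-- through x and 2ʲ x coincide for j ≤ 2. Maximal geometric progressions through a common point
-- coincide, which gives j = 0 and j = 1. For j = 2 and 2x ∉ Tₙ the pair x, 4x must lie in a
-- chain of type B, i.e. neither x/2 nor 8x may lie in Tₙ. This holds because Tₙ is, modulo 2,
-- H₈ times the squares of T_{n-1}, whose elements are s², 3s² (class 13), 2s², 6s² (class 26) or
-- 5s², 7s² (class 57); these classes are disjoint, and only class 57 is compatible with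
-- x, 4x ∈ Tₙ, 2x ∉ Tₙ, while its halves and octuples lie in no class at all.

module Submission where

open import Defs
open import Algebra.Bundles using (CommutativeRing)
open import Data.Bool using (Bool; true; false; _xor_)
open import Data.Bool.Properties
  using (¬-not; xor-assoc; xor-same; xor-identityʳ; not-involutive; xor-∧-commutativeRing; T-≡)
open import Data.Empty using (⊥; ⊥-elim)
open import Data.List using (List; []; _∷_; _++_; map; concatMap; length)
open import Data.List.Membership.Propositional using (_∈_; _∉_; find)
open import Data.List.Membership.Propositional.Properties using (∈-map⁻; ∈-concatMap⁻)
open import Data.List.Relation.Unary.All as All using (All; []; _∷_)
open import Data.List.Relation.Unary.AllPairs using ([]; _∷_)
open import Data.List.Relation.Unary.Any as Any using (Any; here; there)
open import Data.List.Relation.Unary.Unique.Propositional using (Unique)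
open import Data.Nat hiding (parity)
open import Data.Nat.Divisibility
  using (_∣_; module _∣_; _∤_; divides; divides-refl; _∣?_; ∣m⇒∣m*n; m∣m*n; ∣1⇒≡1; ∣⇒≤)
open import Data.Nat.Induction using (<-rec)
open import Data.Nat.ListAction using (sum)
open import Data.Nat.Primality
  using (Prime; prime?; euclidsLemma; prime⇒nonZero; prime⇒nonTrivial; prime[2]; ¬prime[1])
open import Data.Nat.Properties
open import Data.Nat.Tactic.RingSolver using (solve-∀)
open import Data.List.Membership.DecPropositional _≟_ using (_∈?_)
open import Data.Product using (∃; ∃₂; _×_; _,_; proj₁; proj₂)
open import Data.Sum as Sum using (_⊎_; inj₁; inj₂)
open import Function using (_∘_; flip; _⇔_; mk⇔; Equivalence; case_of_)
open import Relation.Binary.Definitions using (tri<; tri≈; tri>)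
open import Relation.Binary.PropositionalEquality
open import Relation.Nullary using (¬_; yes; no; proof)
open import Relation.Nullary.Decidable as Dec
  using (from-yes; from-no; True; False; toWitness; toWitnessFalse)
open import Relation.Nullary.Reflects using (Reflects; ofʸ; ofⁿ)
open import Relation.Unary using (Decidable)
open import Algebra.Properties.CommutativeSemigroup
  (CommutativeRing.+-commutativeSemigroup xor-∧-commutativeRing)
  using (interchange; x∙yz≈y∙xz)
open import Algebra.Solver.CommutativeMonoid
  (CommutativeRing.+-commutativeMonoid xor-∧-commutativeRing)
  using (solve; _⊜_; _⊕_) renaming (id to ε)

open ≡-Reasoning
open _∣_ using (quotient; equality)

-- Counting modulo 2

≡ᵇ-reflects : ∀ m n → Reflects (m ≡ n) (m ≡ᵇ n)
≡ᵇ-reflects m n = proof (m ≟ n)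

≡ᵇ-refl : ∀ m → (m ≡ᵇ m) ≡ true
≡ᵇ-refl m = Equivalence.to T-≡ (≡⇒≡ᵇ m m refl)

≢⇒≡ᵇ≡false : ∀ {m n} → m ≢ n → (m ≡ᵇ n) ≡ false
≢⇒≡ᵇ≡false {m} {n} m≢n with m ≡ᵇ n | ≡ᵇ-reflects m n
... | true  | ofʸ m≡n = ⊥-elim (m≢n m≡n)
... | false | _       = refl

xor-cancelˡ : ∀ a b → a xor (a xor b) ≡ b
xor-cancelˡ false b = refl
xor-cancelˡ true  b = not-involutive b

xor≡false⇒≡ : ∀ {a b} → a xor b ≡ false → a ≡ b
xor≡false⇒≡ {false} {false} _ = refl
xor≡false⇒≡ {true}  {true}  _ = refl

xorSum : (ℕ → Bool) → List ℕ → Bool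
xorSum g []       = false
xorSum g (a ∷ as) = g a xor xorSum g as

parity : ℕ → List ℕ → Bool
parity m = xorSum (m ≡ᵇ_)

xorSum-++ : ∀ g A B → xorSum g (A ++ B) ≡ xorSum g A xor xorSum g B
xorSum-++ g []      B = refl
xorSum-++ g (a ∷ A) B =
  trans (cong (g a xor_) (xorSum-++ g A B)) (sym (xor-assoc (g a) _ _))

xorSum-map : ∀ g f L → xorSum g (map f L) ≡ xorSum (g ∘ f) L
xorSum-map g f []      = refl
xorSum-map g f (a ∷ L) = cong (g (f a) xor_) (xorSum-map g f L)

xorSum-concatMap : ∀ g f L → xorSum g (concatMap f L) ≡ xorSum (xorSum g ∘ f) L
xorSum-concatMap g f []      = refl
xorSum-concatMap g f (a ∷ L) =
  trans (xorSum-++ g (f a) (concatMap f L)) (cong (xorSum g (f a) xor_) (xorSum-concatMap g f L))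

xorSum-cong : ∀ {f h} → (∀ a → f a ≡ h a) → ∀ L → xorSum f L ≡ xorSum h L
xorSum-cong f≗h []      = refl
xorSum-cong f≗h (a ∷ L) = cong₂ _xor_ (f≗h a) (xorSum-cong f≗h L)

xorSum-xor : ∀ f h L → xorSum (λ a → f a xor h a) L ≡ xorSum f L xor xorSum h L
xorSum-xor f h []      = refl
xorSum-xor f h (a ∷ L) =
  trans (cong ((f a xor h a) xor_) (xorSum-xor f h L)) (interchange (f a) (h a) _ _)

xorSum-false : ∀ L → xorSum (λ _ → false) L ≡ false
xorSum-false []      = refl
xorSum-false (a ∷ L) = xorSum-false L

xorSum-swap : ∀ (f : ℕ → ℕ → Bool) A B →
              xorSum (λ a → xorSum (f a) B) A ≡ xorSum (λ b → xorSum (flip f b) A) B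
xorSum-swap f []      B = sym (xorSum-false B)
xorSum-swap f (a ∷ A) B = trans (cong (xorSum (f a) B xor_) (xorSum-swap f A B))
                                (sym (xorSum-xor (f a) (λ b → xorSum (flip f b) A) B))

xorSum-toggle : ∀ g x A → xorSum g (toggle x A) ≡ g x xor xorSum g A
xorSum-toggle g x []       = refl
xorSum-toggle g x (y ∷ ys) with x ≡ᵇ y | ≡ᵇ-reflects x y
... | true  | ofʸ refl = sym (xor-cancelˡ (g x) _)
... | false | _        =
  trans (cong (g y xor_) (xorSum-toggle g x ys)) (x∙yz≈y∙xz (g y) (g x) _)

xorSum-oddSet : ∀ g L → xorSum g (oddSet L) ≡ xorSum g L
xorSum-oddSet g []      = refl
xorSum-oddSet g (a ∷ L) =
  trans (xorSum-toggle g a (oddSet L)) (cong (g a xor_) (xorSum-oddSet g L))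

parity≡true⇒∈ : ∀ {m} L → parity m L ≡ true → m ∈ L
parity≡true⇒∈ {m} (a ∷ L) odd with m ≡ᵇ a | ≡ᵇ-reflects m a
... | true  | ofʸ m≡a = here m≡a
... | false | _       = there (parity≡true⇒∈ L odd)

∉⇒parity≡false : ∀ {m} L → m ∉ L → parity m L ≡ false
∉⇒parity≡false {m} L m∉L with parity m L in odd
... | true  = ⊥-elim (m∉L (parity≡true⇒∈ L odd))
... | false = refl

unique-∈⇒parity≡true : ∀ {m L} → Unique L → m ∈ L → parity m L ≡ true
unique-∈⇒parity≡true {m} {a ∷ L} (a∉L ∷ _) (here refl) =
  cong₂ _xor_ (≡ᵇ-refl m) (∉⇒parity≡false L (λ m∈L → All.lookup a∉L m∈L refl))
unique-∈⇒parity≡true {m} {a ∷ L} (a∉L ∷ L!) (there m∈L) =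
  cong₂ _xor_ (≢⇒≡ᵇ≡false {m} {a} λ { refl → All.lookup a∉L m∈L refl })
              (unique-∈⇒parity≡true L! m∈L)

toggle-∈⁻ : ∀ {z} x A → z ∈ toggle x A → z ≡ x ⊎ z ∈ A
toggle-∈⁻ x []       (here z≡x) = inj₁ z≡x
toggle-∈⁻ x (y ∷ ys) z∈         with x ≡ᵇ y
toggle-∈⁻ x (y ∷ ys) z∈          | true  = inj₂ (there z∈)
toggle-∈⁻ x (y ∷ ys) (here z≡y)  | false = inj₂ (here z≡y)
toggle-∈⁻ x (y ∷ ys) (there z∈)  | false = Sum.map₂ there (toggle-∈⁻ x ys z∈)

toggle-unique : ∀ x A → Unique A → Unique (toggle x A)
toggle-unique x []       []          = [] ∷ []
toggle-unique x (y ∷ ys) (y∉ys ∷ ys!) with x ≡ᵇ y | ≡ᵇ-reflects x y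
... | true  | _        = ys!
... | false | ofⁿ x≢y  = All.tabulate y∉toggle ∷ toggle-unique x ys ys!
  where
  y∉toggle : ∀ {z} → z ∈ toggle x ys → y ≢ z
  y∉toggle z∈ with toggle-∈⁻ x ys z∈
  ... | inj₁ refl = x≢y ∘ sym
  ... | inj₂ z∈ys = All.lookup y∉ys z∈ys

oddSet-unique : ∀ L → Unique (oddSet L)
oddSet-unique []      = []
oddSet-unique (a ∷ L) = toggle-unique a (oddSet L) (oddSet-unique L)

∈-oddSet⇔ : ∀ {m} L → m ∈ oddSet L ⇔ parity m L ≡ true
∈-oddSet⇔ {m} L = mk⇔
  (λ m∈ → trans (sym (xorSum-oddSet (m ≡ᵇ_) L)) (unique-∈⇒parity≡true (oddSet-unique L) m∈))
  (λ odd → parity≡true⇒∈ (oddSet L) (trans (xorSum-oddSet (m ≡ᵇ_) L) odd))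

infix 4 _≈₂_
record _≈₂_ (A B : List ℕ) : Set where
  constructor mk≈₂
  field parity-≡ : ∀ m → parity m A ≡ parity m B
open _≈₂_

≈₂-refl : ∀ {A} → A ≈₂ A
≈₂-refl = mk≈₂ λ m → refl

≈₂-sym : ∀ {A B} → A ≈₂ B → B ≈₂ A
≈₂-sym A≈B = mk≈₂ λ m → sym (parity-≡ A≈B m)

≈₂-trans : ∀ {A B C} → A ≈₂ B → B ≈₂ C → A ≈₂ C
≈₂-trans A≈B B≈C = mk≈₂ λ m → trans (parity-≡ A≈B m) (parity-≡ B≈C m)

length-toggle-∈ : ∀ {x} A → x ∈ A → suc (length (toggle x A)) ≡ length A
length-toggle-∈ {x} (y ∷ ys) x∈ with x ≡ᵇ y | ≡ᵇ-reflects x y | x∈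
... | true  | _       | _          = refl
... | false | ofⁿ x≢y | here x≡y   = ⊥-elim (x≢y x≡y)
... | false | _       | there x∈ys = cong suc (length-toggle-∈ ys x∈ys)

-- The head of a list of even multiplicities occurs again in its tail, and removing both copies
-- keeps all multiplicities even.
xorSum-even : ∀ {n} L → length L ≤ n → L ≈₂ [] → ∀ g → xorSum g L ≡ false
xorSum-even []      _ _ g = refl
xorSum-even {suc n} (x ∷ L) (s≤s |L|≤n) even g = begin
  g x xor xorSum g L     ≡⟨ xorSum-toggle g x L ⟨
  xorSum g (toggle x L)  ≡⟨ xorSum-even (toggle x L) |L′|≤n even′ g ⟩
  false                  ∎
  where
  x∈L : x ∈ L
  x∈L = parity≡true⇒∈ L (trans (sym (xor≡false⇒≡ (parity-≡ even x))) (≡ᵇ-refl x))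
  even′ : toggle x L ≈₂ []
  even′ = mk≈₂ λ m → trans (xorSum-toggle (m ≡ᵇ_) x L) (parity-≡ even m)
  |L′|≤n : length (toggle x L) ≤ n
  |L′|≤n = ≤-trans (n≤1+n _) (subst (_≤ n) (sym (length-toggle-∈ L x∈L)) |L|≤n)

xorSum-resp-≈₂ : ∀ {A B} → A ≈₂ B → ∀ g → xorSum g A ≡ xorSum g B
xorSum-resp-≈₂ {A} {B} A≈B g =
  xor≡false⇒≡ (trans (sym (xorSum-++ g A B)) (xorSum-even (A ++ B) ≤-refl A++B≈[] g))
  where
  A++B≈[] : A ++ B ≈₂ []
  A++B≈[] = mk≈₂ λ m → begin
    parity m (A ++ B)            ≡⟨ xorSum-++ (m ≡ᵇ_) A B ⟩
    parity m A xor parity m B    ≡⟨ cong (_xor parity m B) (parity-≡ A≈B m) ⟩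
    parity m B xor parity m B    ≡⟨ xor-same (parity m B) ⟩
    false                        ∎

oddSet-≈₂ : ∀ L → oddSet L ≈₂ L
oddSet-≈₂ L = mk≈₂ λ m → xorSum-oddSet (m ≡ᵇ_) L

map-≈₂ : ∀ f {A A′} → A ≈₂ A′ → map f A ≈₂ map f A′
map-≈₂ f {A} {A′} A≈A′ = mk≈₂ λ m → begin
  parity m (map f A)        ≡⟨ xorSum-map (m ≡ᵇ_) f A ⟩
  xorSum ((m ≡ᵇ_) ∘ f) A    ≡⟨ xorSum-resp-≈₂ A≈A′ ((m ≡ᵇ_) ∘ f) ⟩
  xorSum ((m ≡ᵇ_) ∘ f) A′   ≡⟨ xorSum-map (m ≡ᵇ_) f A′ ⟨
  parity m (map f A′)       ∎

infixl 7 _⊗_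
_⊗_ : List ℕ → List ℕ → List ℕ
A ⊗ B = concatMap (λ a → map (a *_) B) A

xorSum-⊗ : ∀ g A B → xorSum g (A ⊗ B) ≡ xorSum (λ a → xorSum (λ b → g (a * b)) B) A
xorSum-⊗ g A B = trans (xorSum-concatMap g _ A) (xorSum-cong (λ a → xorSum-map g (a *_) B) A)

⊗-congˡ : ∀ {A A′} B → A ≈₂ A′ → A ⊗ B ≈₂ A′ ⊗ B
⊗-congˡ {A} {A′} B A≈A′ = mk≈₂ λ m → begin
  parity m (A ⊗ B)                               ≡⟨ xorSum-⊗ (m ≡ᵇ_) A B ⟩
  xorSum (λ a → xorSum (λ b → m ≡ᵇ a * b) B) A   ≡⟨ xorSum-resp-≈₂ A≈A′ _ ⟩
  xorSum (λ a → xorSum (λ b → m ≡ᵇ a * b) B) A′  ≡⟨ xorSum-⊗ (m ≡ᵇ_) A′ B ⟨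
  parity m (A′ ⊗ B)                              ∎

⊗-comm : ∀ A B → A ⊗ B ≈₂ B ⊗ A
⊗-comm A B = mk≈₂ λ m → begin
  parity m (A ⊗ B)                               ≡⟨ xorSum-⊗ (m ≡ᵇ_) A B ⟩
  xorSum (λ a → xorSum (λ b → m ≡ᵇ a * b) B) A   ≡⟨ xorSum-swap (λ a b → m ≡ᵇ a * b) A B ⟩
  xorSum (λ b → xorSum (λ a → m ≡ᵇ a * b) A) B   ≡⟨ xorSum-cong (λ b → xorSum-cong
                                                      (λ a → cong (m ≡ᵇ_) (*-comm a b)) A) B ⟩
  xorSum (λ b → xorSum (λ a → m ≡ᵇ b * a) A) B   ≡⟨ xorSum-⊗ (m ≡ᵇ_) B A ⟨
  parity m (B ⊗ A)                               ∎

⊗-assoc : ∀ A B C → (A ⊗ B) ⊗ C ≈₂ A ⊗ (B ⊗ C)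
⊗-assoc A B C = mk≈₂ λ m → begin
  parity m ((A ⊗ B) ⊗ C)
    ≡⟨ xorSum-⊗ (m ≡ᵇ_) (A ⊗ B) C ⟩
  xorSum (λ x → xorSum (λ c → m ≡ᵇ x * c) C) (A ⊗ B)
    ≡⟨ xorSum-⊗ (λ x → xorSum (λ c → m ≡ᵇ x * c) C) A B ⟩
  xorSum (λ a → xorSum (λ b → xorSum (λ c → m ≡ᵇ a * b * c) C) B) A
    ≡⟨ xorSum-cong (λ a → xorSum-cong (λ b → xorSum-cong
         (λ c → cong (m ≡ᵇ_) (*-assoc a b c)) C) B) A ⟩
  xorSum (λ a → xorSum (λ b → xorSum (λ c → m ≡ᵇ a * (b * c)) C) B) A
    ≡⟨ xorSum-cong (λ a → xorSum-⊗ (λ y → m ≡ᵇ a * y) B C) A ⟨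
  xorSum (λ a → xorSum (λ y → m ≡ᵇ a * y) (B ⊗ C)) A
    ≡⟨ xorSum-⊗ (m ≡ᵇ_) A (B ⊗ C) ⟨
  parity m (A ⊗ (B ⊗ C))
    ∎

⊗-identityʳ : ∀ A → A ⊗ (1 ∷ []) ≈₂ A
⊗-identityʳ A = mk≈₂ λ m → trans (xorSum-⊗ (m ≡ᵇ_) A (1 ∷ []))
  (xorSum-cong (λ a → trans (xor-identityʳ _) (cong (m ≡ᵇ_) (*-identityʳ a))) A)

square : ℕ → ℕ
square x = x * x

-- (Σ a)² ≡ Σ a² modulo 2: the cross terms a b and b a cancel.
⊗-self : ∀ A → A ⊗ A ≈₂ map square A
⊗-self A = mk≈₂ (self A)
  where
  self : ∀ A m → parity m (A ⊗ A) ≡ parity m (map square A)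
  self []      m = refl
  self (a ∷ A) m = begin
    parity m ((a ∷ A) ⊗ (a ∷ A))
      ≡⟨ xorSum-⊗ (m ≡ᵇ_) (a ∷ A) (a ∷ A) ⟩
    ((m ≡ᵇ a * a) xor row a) xor xorSum (λ c → (m ≡ᵇ c * a) xor row c) A
      ≡⟨ cong (((m ≡ᵇ a * a) xor row a) xor_) (xorSum-xor (λ c → m ≡ᵇ c * a) row A) ⟩
    ((m ≡ᵇ a * a) xor row a) xor (xorSum (λ c → m ≡ᵇ c * a) A xor xorSum row A)
      ≡⟨ cong (λ t → ((m ≡ᵇ a * a) xor row a) xor (t xor xorSum row A)) column≡row ⟩
    ((m ≡ᵇ a * a) xor row a) xor (row a xor xorSum row A)
      ≡⟨ xor-assoc (m ≡ᵇ a * a) (row a) _ ⟩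
    (m ≡ᵇ a * a) xor (row a xor (row a xor xorSum row A))
      ≡⟨ cong ((m ≡ᵇ a * a) xor_) (xor-cancelˡ (row a) _) ⟩
    (m ≡ᵇ a * a) xor xorSum row A
      ≡⟨ cong ((m ≡ᵇ a * a) xor_) (trans (sym (xorSum-⊗ (m ≡ᵇ_) A A)) (self A m)) ⟩
    parity m (map square (a ∷ A))
      ∎
    where
    row : ℕ → Bool
    row c = xorSum (λ b → m ≡ᵇ c * b) A
    column≡row : xorSum (λ c → m ≡ᵇ c * a) A ≡ row a
    column≡row = xorSum-cong (λ c → cong (m ≡ᵇ_) (*-comm c a)) A

∈-⊗⁻ : ∀ {m} A B → m ∈ A ⊗ B → ∃₂ λ a b → a ∈ A × b ∈ B × m ≡ a * b
∈-⊗⁻ A B m∈ with find (∈-concatMap⁻ (λ a → map (a *_) B) {A} m∈)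
... | a , a∈A , m∈aB with ∈-map⁻ (a *_) m∈aB
...   | b , b∈B , m≡ab = a , b , a∈A , b∈B , m≡ab

∇-self : ∀ C → C ∇ C ≈₂ map square C
∇-self C = ≈₂-trans (oddSet-≈₂ (C ⊗ C)) (⊗-self C)

∈-∇⇔ : ∀ {m} A B → m ∈ A ∇ B ⇔ parity m (A ⊗ B) ≡ true
∈-∇⇔ A B = ∈-oddSet⇔ (A ⊗ B)

∈-[C∇C]∇D⁻ : ∀ {m} C D → m ∈ (C ∇ C) ∇ D → ∃₂ λ c d → c ∈ C × d ∈ D × m ≡ square c * d
∈-[C∇C]∇D⁻ {m} C D m∈ with ∈-⊗⁻ (map square C) D (parity≡true⇒∈ _ odd)
  where
  odd : parity m (map square C ⊗ D) ≡ true
  odd = trans (sym (parity-≡ (⊗-congˡ D (∇-self C)) m))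
              (Equivalence.to (∈-∇⇔ (C ∇ C) D) m∈)
... | a , d , a∈ , d∈D , m≡ad with ∈-map⁻ square a∈
...   | c , c∈C , refl = c , d , c∈C , d∈D , m≡ad

-- Squares and primes

prime∣*∤⇒∣ : ∀ {p m n} → Prime p → p ∣ m * n → p ∤ m → p ∣ n
prime∣*∤⇒∣ {m = m} {n} pr p∣mn p∤m with euclidsLemma m n pr p∣mn
... | inj₁ p∣m = ⊥-elim (p∤m p∣m)
... | inj₂ p∣n = p∣n

prime∤* : ∀ {p m n} → Prime p → p ∤ m → p ∤ n → p ∤ m * n
prime∤* pr p∤m p∤n p∣mn = p∤n (prime∣*∤⇒∣ pr p∣mn p∤m)

prime∣square⇒∣ : ∀ {p m} → Prime p → p ∣ square m → p ∣ m
prime∣square⇒∣ {m = m} pr p∣mm with euclidsLemma m m pr p∣mm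
... | inj₁ p∣m = p∣m
... | inj₂ p∣m = p∣m

-- Infinite descent: p divides both sides, then both square roots, and the equation
-- reappears with a smaller a.
p*k*a²≢l*b² : ∀ {p k l} → Prime p → p ∤ k → p ∤ l →
              ∀ {a b} → 0 < a → p * k * square a ≢ l * square b
p*k*a²≢l*b² {p} {k} {l} pr p∤k p∤l {a} {b} = <-rec Goal descend a {b}
  where
  instance
    p≢0 : NonZero p
    p≢0 = prime⇒nonZero pr
  Goal : ℕ → Set
  Goal a = ∀ {b} → 0 < a → p * k * square a ≢ l * square b
  descend : ∀ a → (∀ {a′} → a′ < a → Goal a′) → Goal a
  descend a smaller {b} 0<a eq = smaller a′<a {b′} 0<a′ eq′
    where
    p∣b : p ∣ b
    p∣b = prime∣square⇒∣ {m = b} pr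
            (prime∣*∤⇒∣ {m = l} pr (subst (p ∣_) eq (∣m⇒∣m*n (square a) (m∣m*n k))) p∤l)
    b′ : ℕ
    b′ = quotient p∣b
    ka²≡p*lb′² : k * square a ≡ p * (l * square b′)
    ka²≡p*lb′² = *-cancelˡ-≡ _ _ p (begin
      p * (k * square a)          ≡⟨ *-assoc p k (square a) ⟨
      p * k * square a            ≡⟨ eq ⟩
      l * square b                ≡⟨ cong (λ x → l * square x) (equality p∣b) ⟩
      l * square (b′ * p)         ≡⟨ rearrange l b′ p ⟩
      p * (p * (l * square b′))   ∎)
      where
      rearrange : ∀ l b′ p → l * ((b′ * p) * (b′ * p)) ≡ p * (p * (l * (b′ * b′)))
      rearrange = solve-∀
    p∣a : p ∣ a
    p∣a = prime∣square⇒∣ {m = a} pr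
            (prime∣*∤⇒∣ {m = k} pr (divides (l * square b′) (trans ka²≡p*lb′² (*-comm p _))) p∤k)
    a′ : ℕ
    a′ = quotient p∣a
    eq′ : p * k * square a′ ≡ l * square b′
    eq′ = *-cancelˡ-≡ _ _ p (begin
      p * (p * k * square a′)     ≡⟨ rearrange p k a′ ⟩
      k * square (a′ * p)         ≡⟨ cong (λ x → k * square x) (equality p∣a) ⟨
      k * square a                ≡⟨ ka²≡p*lb′² ⟩
      p * (l * square b′)         ∎)
      where
      rearrange : ∀ p k a′ → p * (p * k * (a′ * a′)) ≡ k * ((a′ * p) * (a′ * p))
      rearrange = solve-∀
    0<a′ : 0 < a′
    0<a′ = >-nonZero⁻¹ a′ {{m*n≢0⇒m≢0 a′ {{>-nonZero (subst (0 <_) (equality p∣a) 0<a)}}}}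
    a′<a : a′ < a
    a′<a = subst (a′ <_) (sym (equality p∣a))
             (m<m*n a′ p {{>-nonZero 0<a′}} (nonTrivial⇒n>1 p {{prime⇒nonTrivial pr}}))

square-injective : ∀ {m n} → square m ≡ square n → m ≡ n
square-injective {m} {n} eq with <-cmp m n
... | tri< m<n _ _ = ⊥-elim (<-irrefl eq (*-mono-< m<n m<n))
... | tri≈ _ m≡n _ = m≡n
... | tri> _ _ n<m = ⊥-elim (<-irrefl (sym eq) (*-mono-< n<m n<m))

square≡square*2^ : ∀ {c₁ c₂} d → 0 < c₂ → square c₁ ≡ square c₂ * 2 ^ d →
                   ∃ λ j → d ≡ j + j × c₁ ≡ 2 ^ j * c₂
square≡square*2^ {c₁} {c₂} zero 0<c₂ eq =
  0 , refl , trans (square-injective (trans eq (*-identityʳ _))) (sym (+-identityʳ c₂))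
square≡square*2^ {c₁} {c₂} (suc zero) 0<c₂ eq =
  ⊥-elim (p*k*a²≢l*b² prime[2] (from-no (2 ∣? 1)) (from-no (2 ∣? 1)) {b = c₁} 0<c₂ (begin
    2 * 1 * square c₂    ≡⟨ rearrange (square c₂) ⟩
    square c₂ * 2 ^ 1    ≡⟨ eq ⟨
    square c₁            ≡⟨ *-identityˡ _ ⟨
    1 * square c₁        ∎))
  where
  rearrange : ∀ s → 2 * 1 * s ≡ s * 2 ^ 1
  rearrange = solve-∀
square≡square*2^ {c₁} {c₂} (suc (suc d)) 0<c₂ eq = double (square≡square*2^ d 0<c₂ eq′)
  where
  2∣c₁ : 2 ∣ c₁
  2∣c₁ = prime∣square⇒∣ {m = c₁} prime[2]
           (divides (c₂ * c₂ * 2 ^ d * 2) (trans eq (rearrange₁ (c₂ * c₂) (2 ^ d))))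
    where
    rearrange₁ : ∀ s x → s * (2 * (2 * x)) ≡ s * x * 2 * 2
    rearrange₁ = solve-∀
  c′ : ℕ
  c′ = quotient 2∣c₁
  eq′ : square c′ ≡ square c₂ * 2 ^ d
  eq′ = *-cancelˡ-≡ _ _ 4 (begin
    4 * square c′              ≡⟨ rearrange₂ c′ ⟩
    square (c′ * 2)            ≡⟨ cong square (equality 2∣c₁) ⟨
    square c₁                  ≡⟨ eq ⟩
    square c₂ * 2 ^ (2 + d)    ≡⟨ rearrange₃ (square c₂) (2 ^ d) ⟩
    4 * (square c₂ * 2 ^ d)    ∎)
    where
    rearrange₂ : ∀ c → 4 * (c * c) ≡ c * 2 * (c * 2)
    rearrange₂ = solve-∀
    rearrange₃ : ∀ s x → s * (2 * (2 * x)) ≡ 4 * (s * x)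
    rearrange₃ = solve-∀
  double : (∃ λ j → d ≡ j + j × c′ ≡ 2 ^ j * c₂) → ∃ λ j → 2 + d ≡ j + j × c₁ ≡ 2 ^ j * c₂
  double (j , d≡j+j , c′≡2^jc₂) = suc j , cong suc (trans (cong suc d≡j+j) (sym (+-suc j j))) , (begin
    c₁              ≡⟨ equality 2∣c₁ ⟩
    c′ * 2          ≡⟨ cong (_* 2) c′≡2^jc₂ ⟩
    2 ^ j * c₂ * 2  ≡⟨ rearrange (2 ^ j) c₂ ⟩
    2 ^ suc j * c₂  ∎)
    where
    rearrange : ∀ x c → x * c * 2 ≡ 2 * x * c
    rearrange = solve-∀

square*2^-cancel : ∀ {c₁ c₂ e u} → 0 < c₂ → e ≤ u → square c₁ * 2 ^ e ≡ square c₂ * 2 ^ u →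
                   ∃ λ j → u ≡ e + (j + j) × c₁ ≡ 2 ^ j * c₂
square*2^-cancel {c₁} {c₂} {e} {u} 0<c₂ e≤u eq =
  let j , u∸e≡j+j , c₁≡2^jc₂ = square≡square*2^ (u ∸ e) 0<c₂ eq′
  in j , trans (sym (m+[n∸m]≡n e≤u)) (cong (e +_) u∸e≡j+j) , c₁≡2^jc₂
  where
  eq′ : square c₁ ≡ square c₂ * 2 ^ (u ∸ e)
  eq′ = *-cancelʳ-≡ _ _ (2 ^ e) {{m^n≢0 2 e}} (begin
    square c₁ * 2 ^ e                  ≡⟨ eq ⟩
    square c₂ * 2 ^ u                  ≡⟨ cong (λ k → square c₂ * 2 ^ k) (m∸n+n≡m e≤u) ⟨
    square c₂ * 2 ^ (u ∸ e + e)        ≡⟨ cong (square c₂ *_) (^-distribˡ-+-* 2 (u ∸ e) e) ⟩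
    square c₂ * (2 ^ (u ∸ e) * 2 ^ e)  ≡⟨ *-assoc (square c₂) _ _ ⟨
    square c₂ * 2 ^ (u ∸ e) * 2 ^ e    ∎)

odd-prime∤2^ : ∀ {p} → Prime p → p ∤ 2 → ∀ e → p ∤ 2 ^ e
odd-prime∤2^ pr p∤2 zero    p∣1 = ¬prime[1] (subst Prime (∣1⇒≡1 p∣1) pr)
odd-prime∤2^ pr p∤2 (suc e) = prime∤* pr p∤2 (odd-prime∤2^ pr p∤2 e)

square*2^*p≢square*2^*q : ∀ {p q} → Prime p → p ∤ 2 → p ∤ q →
                          ∀ {c₁ c₂ e u} → 0 < c₁ → square c₁ * 2 ^ e * p ≢ square c₂ * 2 ^ u * q
square*2^*p≢square*2^*q {p} {q} pr p∤2 p∤q {c₁} {c₂} {e} {u} 0<c₁ eq =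
  p*k*a²≢l*b² pr (odd-prime∤2^ pr p∤2 e) (prime∤* pr (odd-prime∤2^ pr p∤2 u) p∤q) {b = c₂} 0<c₁ (begin
    p * 2 ^ e * square c₁        ≡⟨ rearrange p (2 ^ e) c₁ ⟩
    square c₁ * 2 ^ e * p        ≡⟨ eq ⟩
    square c₂ * 2 ^ u * q        ≡⟨ rearrange′ q (2 ^ u) c₂ ⟩
    2 ^ u * q * square c₂        ∎)
  where
  rearrange : ∀ p x c → p * x * (c * c) ≡ c * c * x * p
  rearrange = solve-∀
  rearrange′ : ∀ q x c → c * c * x * q ≡ x * q * (c * c)
  rearrange′ = solve-∀

-- Maximal geometric progressions

module Progression (r : ℕ) .{{_ : NonTrivial r}} where

  instance
    r≢0 : NonZero r
    r≢0 = nonTrivial⇒nonZero r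

  r>1 : 1 < r
  r>1 = nonTrivial⇒n>1 r

  r^k≢0 : ∀ k → NonZero (r ^ k)
  r^k≢0 k = m^n≢0 r k

  ^-shift : ∀ k x → r ^ k * (r * x) ≡ r ^ suc k * x
  ^-shift k x = trans (sym (*-assoc (r ^ k) r x)) (cong (_* x) (*-comm (r ^ k) r))

  ^-+ : ∀ a b x → r ^ (a + b) * x ≡ r ^ a * (r ^ b * x)
  ^-+ a b x = trans (cong (_* x) (^-distribˡ-+-* r a b)) (*-assoc (r ^ a) (r ^ b) x)

  ^*-injective : ∀ {j k x} → x ≢ 0 → r ^ j * x ≡ r ^ k * x → j ≡ k
  ^*-injective {j} {k} {x} x≢0 eq with <-cmp j k
  ... | tri< j<k _ _ = ⊥-elim (<-irrefl eq (*-monoˡ-< x {{≢-nonZero x≢0}} (^-monoʳ-< r r>1 j<k)))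
  ... | tri≈ _ j≡k _ = j≡k
  ... | tri> _ _ k<j = ⊥-elim (<-irrefl (sym eq) (*-monoˡ-< x {{≢-nonZero x≢0}} (^-monoʳ-< r r>1 k<j)))

  ∈-geom⁻ : ∀ {z} x ℓ → z ∈ geom r x ℓ → ∃ λ k → k < ℓ × z ≡ r ^ k * x
  ∈-geom⁻ x (suc ℓ) (here z≡x) = 0 , z<s , trans z≡x (sym (*-identityˡ x))
  ∈-geom⁻ x (suc ℓ) (there z∈) =
    let k , k<ℓ , z≡ = ∈-geom⁻ (r * x) ℓ z∈ in suc k , s<s k<ℓ , trans z≡ (^-shift k x)

  ∈-geom⁺ : ∀ x {ℓ k} → k < ℓ → r ^ k * x ∈ geom r x ℓ
  ∈-geom⁺ x {suc ℓ} {zero}  _         = here (*-identityˡ x)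
  ∈-geom⁺ x {suc ℓ} {suc k} (s<s k<ℓ) =
    there (subst (_∈ geom r (r * x) ℓ) (^-shift k x) (∈-geom⁺ (r * x) k<ℓ))

  x∈geom : ∀ {x ℓ} → 0 < ℓ → x ∈ geom r x ℓ
  x∈geom {ℓ = suc ℓ} _ = here refl

  maxGeom⊆ : ∀ {P S z} → IsMaxGeom r P S → z ∈ S → P z
  maxGeom⊆ (_ , _ , _ , _ , all , _) = All.lookup all

  maxGeom-nonempty : ∀ {P S} → IsMaxGeom r P S → ∃ λ z → z ∈ S
  maxGeom-nonempty (x , _ , 2≤ℓ , refl , _) = x , x∈geom (≤-trans (s≤s z≤n) 2≤ℓ)

  module _ (P : ℕ → Set) where

    record Run (x ℓ : ℕ) : Set where
      field
        inside : ∀ {k} → k < ℓ → P (r ^ k * x)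
        start  : ∀ {w} → x ≡ r * w → ¬ P w
        stop   : ¬ P (r ^ ℓ * x)
    open Run

    run⇒isMaxGeom : ∀ {x ℓ} → 2 ≤ ℓ → Run x ℓ → IsMaxGeom r P (geom r x ℓ)
    run⇒isMaxGeom {x} {ℓ} 2≤ℓ run = x , ℓ , 2≤ℓ , refl , All.tabulate inside′ , maximal
      where
      inside′ : ∀ {z} → z ∈ geom r x ℓ → P z
      inside′ z∈ = let k , k<ℓ , z≡ = ∈-geom⁻ x ℓ z∈ in subst P (sym z≡) (inside run k<ℓ)
      within : ∀ {ℓ′ z} → All P (geom r x ℓ′) → z ∈ geom r x ℓ′ → z ∈ geom r x ℓ
      within {ℓ′} all′ z∈ with ∈-geom⁻ x ℓ′ z∈
      ... | k , k<ℓ′ , refl with k <? ℓ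
      ...   | yes k<ℓ = ∈-geom⁺ x k<ℓ
      ...   | no k≮ℓ  = ⊥-elim (stop run (All.lookup all′ (∈-geom⁺ x (≤-<-trans (≮⇒≥ k≮ℓ) k<ℓ′))))
      maximal : ∀ x′ ℓ′ → 2 ≤ ℓ′ → All P (geom r x′ ℓ′) →
                geom r x ℓ ⊆ geom r x′ ℓ′ → geom r x′ ℓ′ ⊆ geom r x ℓ
      maximal x′ ℓ′ _ all′ sub z∈ with ∈-geom⁻ x′ ℓ′ (sub (x∈geom (≤-trans (s≤s z≤n) 2≤ℓ)))
      ... | suc b , b<ℓ′ , x≡ =
        ⊥-elim (start run (trans x≡ (*-assoc r (r ^ b) x′))
                          (All.lookup all′ (∈-geom⁺ x′ (<-trans (n<1+n b) b<ℓ′))))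
      ... | zero , _ , x≡ with trans x≡ (*-identityˡ x′)
      ...   | refl = within all′ z∈

    mkRun : ∀ {x ℓ} → All P (geom r x ℓ) → r ∤ x → ¬ P (r ^ ℓ * x) → Run x ℓ
    mkRun {x} all r∤x stop = record
      { inside = λ k<ℓ → All.lookup all (∈-geom⁺ x k<ℓ)
      ; start  = λ {w} x≡rw _ → r∤x (divides w (trans x≡rw (*-comm r w)))
      ; stop   = stop
      }

    all-geom : ∀ {x ℓ} → (∀ {k} → k < ℓ → P (r ^ k * x)) → All P (geom r x ℓ)
    all-geom {x} {ℓ} inside = All.tabulate λ z∈ →
      let k , k<ℓ , z≡ = ∈-geom⁻ x ℓ z∈ in subst P (sym z≡) (inside k<ℓ)

    isMaxGeom⇒run : ¬ P 0 → ∀ {S} → IsMaxGeom r P S → ∃₂ λ x ℓ → S ≡ geom r x ℓ × Run x ℓ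
    isMaxGeom⇒run ¬P0 (x , ℓ , 2≤ℓ , refl , all , maximal) = x , ℓ , refl , run
      where
      0<ℓ : 0 < ℓ
      0<ℓ = ≤-trans (s≤s z≤n) 2≤ℓ
      inside′ : ∀ {k} → k < ℓ → P (r ^ k * x)
      inside′ k<ℓ = All.lookup all (∈-geom⁺ x k<ℓ)
      x≢0 : x ≢ 0
      x≢0 refl = ¬P0 (All.lookup all (x∈geom 0<ℓ))
      -- prolonging the run backwards to w or forwards to r^ℓ x contradicts maximality
      back∈ : ∀ {w} → x ≡ r * w → P w → w ∈ geom r x ℓ
      back∈ {w} refl Pw =
        maximal w (suc ℓ) (≤-trans 2≤ℓ (n≤1+n ℓ)) (all-geom inside-w) x-run⊆w-run (here refl)
        where
        inside-w : ∀ {k} → k < suc ℓ → P (r ^ k * w)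
        inside-w {zero}  _         = subst P (sym (*-identityˡ w)) Pw
        inside-w {suc k} (s<s k<ℓ) = subst P (^-shift k w) (inside′ k<ℓ)
        x-run⊆w-run : geom r (r * w) ℓ ⊆ geom r w (suc ℓ)
        x-run⊆w-run z∈ = let k , k<ℓ , z≡ = ∈-geom⁻ (r * w) ℓ z∈ in
          subst (_∈ geom r w (suc ℓ)) (sym (trans z≡ (^-shift k w))) (∈-geom⁺ w (s<s k<ℓ))
      start′ : ∀ {w} → x ≡ r * w → ¬ P w
      start′ {w} refl Pw with ∈-geom⁻ (r * w) ℓ (back∈ refl Pw)
      ... | k , _ , w≡ =
        0≢1+n (^*-injective {0} {suc k} (λ { refl → ¬P0 Pw })
                             (trans (*-identityˡ w) (trans w≡ (^-shift k w))))
      next∈ : P (r ^ ℓ * x) → r ^ ℓ * x ∈ geom r x ℓ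
      next∈ P-next = maximal x (suc ℓ) (≤-trans 2≤ℓ (n≤1+n ℓ)) (all-geom inside-next) run⊆next
                       (∈-geom⁺ x (n<1+n ℓ))
        where
        inside-next : ∀ {k} → k < suc ℓ → P (r ^ k * x)
        inside-next {k} (s≤s k≤ℓ) with m≤n⇒m<n∨m≡n k≤ℓ
        ... | inj₁ k<ℓ = inside′ k<ℓ
        ... | inj₂ refl = P-next
        run⊆next : geom r x ℓ ⊆ geom r x (suc ℓ)
        run⊆next z∈ = let k , k<ℓ , z≡ = ∈-geom⁻ x ℓ z∈ in
          subst (_∈ geom r x (suc ℓ)) (sym z≡) (∈-geom⁺ x (<-trans k<ℓ (n<1+n ℓ)))
      stop′ : ¬ P (r ^ ℓ * x)
      stop′ P-next with ∈-geom⁻ x ℓ (next∈ P-next)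
      ... | k , k<ℓ , r^ℓx≡ = <-irrefl (sym (^*-injective x≢0 r^ℓx≡)) k<ℓ
      run : Run x ℓ
      run = record { inside = inside′ ; start = start′ ; stop = stop′ }

    run-start-unreachable : ∀ {x ℓ x′ ℓ′ a b} → Run x ℓ → Run x′ ℓ′ →
                            r ^ a * x ≡ r ^ b * x′ → b < ℓ′ → ¬ a < b
    run-start-unreachable {x} {ℓ} {x′} {ℓ′} {a} {b} run run′ eq b<ℓ′ a<b =
      start run x≡ (inside run′ {c} (≤-trans (m≤n+m (suc c) a) (<⇒≤ (subst (_< ℓ′) b≡ b<ℓ′))))
      where
      c : ℕ
      c = b ∸ suc a
      b≡ : b ≡ a + suc c
      b≡ = trans (sym (m+[n∸m]≡n a<b)) (sym (+-suc a c))
      x≡ : x ≡ r * (r ^ c * x′)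
      x≡ = *-cancelˡ-≡ _ _ (r ^ a) {{r^k≢0 a}} (begin
        r ^ a * x                    ≡⟨ eq ⟩
        r ^ b * x′                   ≡⟨ cong (λ k → r ^ k * x′) b≡ ⟩
        r ^ (a + suc c) * x′         ≡⟨ ^-+ a (suc c) x′ ⟩
        r ^ a * (r * r ^ c * x′)     ≡⟨ cong (r ^ a *_) (*-assoc r (r ^ c) x′) ⟩
        r ^ a * (r * (r ^ c * x′))   ∎)

    run-unique : ∀ {x ℓ x′ ℓ′ z} → Run x ℓ → Run x′ ℓ′ →
                 z ∈ geom r x ℓ → z ∈ geom r x′ ℓ′ → x ≡ x′ × ℓ ≡ ℓ′
    run-unique {x} {ℓ} {x′} {ℓ′} run run′ z∈ z∈′
      with ∈-geom⁻ x ℓ z∈ | ∈-geom⁻ x′ ℓ′ z∈′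
    ... | a , a<ℓ , z≡ | b , b<ℓ′ , z≡′ = x≡x′ , ℓ≡ℓ′
      where
      eq : r ^ a * x ≡ r ^ b * x′
      eq = trans (sym z≡) z≡′
      x≡x′ : x ≡ x′
      x≡x′ with <-cmp a b
      ... | tri< a<b _ _ = ⊥-elim (run-start-unreachable run run′ eq b<ℓ′ a<b)
      ... | tri≈ _ refl _ = *-cancelˡ-≡ _ _ (r ^ a) {{r^k≢0 a}} eq
      ... | tri> _ _ b<a = ⊥-elim (run-start-unreachable run′ run (sym eq) a<ℓ b<a)
      ℓ≡ℓ′ : ℓ ≡ ℓ′
      ℓ≡ℓ′ with <-cmp ℓ ℓ′
      ... | tri< ℓ<ℓ′ _ _ =
        ⊥-elim (stop run (subst (λ y → P (r ^ ℓ * y)) (sym x≡x′) (inside run′ ℓ<ℓ′)))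
      ... | tri≈ _ ℓ≡ℓ′ _ = ℓ≡ℓ′
      ... | tri> _ _ ℓ′<ℓ =
        ⊥-elim (stop run′ (subst (λ y → P (r ^ ℓ′ * y)) x≡x′ (inside run ℓ′<ℓ)))

    maxGeom-unique : ¬ P 0 → ∀ {S₁ S₂ z} → IsMaxGeom r P S₁ → IsMaxGeom r P S₂ →
                     z ∈ S₁ → z ∈ S₂ → S₁ ≡ S₂
    maxGeom-unique ¬P0 max₁ max₂ z∈₁ z∈₂
      with isMaxGeom⇒run ¬P0 max₁ | isMaxGeom⇒run ¬P0 max₂
    ... | x , ℓ , refl , run | x′ , ℓ′ , refl , run′ =
      let x≡x′ , ℓ≡ℓ′ = run-unique run run′ z∈₁ z∈₂ in cong₂ (geom r) x≡x′ ℓ≡ℓ′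

    maxGeom-neighbour : ∀ {S z} → IsMaxGeom r P S → z ∈ S → P (r * z) ⊎ ∃ λ w → z ≡ r * w × P w
    maxGeom-neighbour (x , ℓ , 2≤ℓ , refl , all , _) z∈ with ∈-geom⁻ x ℓ z∈
    ... | zero , _ , refl = inj₁ (subst P (*-assoc r 1 x) (All.lookup all (∈-geom⁺ x {k = 1} 2≤ℓ)))
    ... | suc k , k<ℓ , refl = inj₂ (r ^ k * x , *-assoc r (r ^ k) x ,
                                All.lookup all (∈-geom⁺ x (<-trans (n<1+n k) k<ℓ)))

    module _ (P? : Decidable P) (¬P0 : ¬ P 0) {B : ℕ} (bounded : ∀ {z} → P z → z ≤ B) where

      private
        x<r*x : ∀ {x} → P x → x < r * x
        x<r*x {x} Px = subst (x <_) (*-comm x r)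
          (m<m*n x r {{≢-nonZero λ { refl → ¬P0 Px }}} r>1)

      Descent : ℕ → Set
      Descent x = ∃₂ λ x₀ a → x ≡ r ^ a * x₀ × (∀ {k} → k ≤ a → P (r ^ k * x₀)) ×
                              (∀ {w} → x₀ ≡ r * w → ¬ P w)

      descend : ∀ x → P x → Descent x
      descend = <-rec (λ x → P x → Descent x) step
        where
        stay : ∀ {x} → P x → (∀ {w} → x ≡ r * w → ¬ P w) → Descent x
        stay {x} Px start =
          x , 0 , sym (*-identityˡ x) , (λ { z≤n → subst P (sym (*-identityˡ x)) Px }) , start
        step : ∀ x → (∀ {y} → y < x → P y → Descent y) → P x → Descent x
        step x smaller Px with r ∣? x
        ... | no r∤x = stay Px λ {w} x≡rw _ → r∤x (divides w (trans x≡rw (*-comm r w)))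
        ... | yes (divides-refl w) with P? w
        ...   | no ¬Pw = stay Px λ {w′} w*r≡r*w′ Pw′ →
                  ¬Pw (subst P (*-cancelʳ-≡ w′ w r (trans (*-comm w′ r) (sym w*r≡r*w′))) Pw′)
        ...   | yes Pw = lower (smaller (subst (w <_) (*-comm r w) (x<r*x Pw)) Pw)
          where
          lower : Descent w → Descent (w * r)
          lower (x₀ , a , w≡ , below , start) = x₀ , suc a , w*r≡ , below′ , start
            where
            w*r≡ : w * r ≡ r ^ suc a * x₀
            w*r≡ = trans (*-comm w r) (trans (cong (r *_) w≡) (sym (*-assoc r (r ^ a) x₀)))
            below′ : ∀ {k} → k ≤ suc a → P (r ^ k * x₀)
            below′ k≤ with m≤n⇒m<n∨m≡n k≤
            ... | inj₁ (s≤s k≤a) = below k≤a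
            ... | inj₂ refl      = subst P w*r≡ Px

      Ascent : ℕ → Set
      Ascent y = ∃ λ ℓ → (∀ {k} → k < ℓ → P (r ^ k * y)) × ¬ P (r ^ ℓ * y)

      ascend : ∀ n {y} → B < n + y → P y → Ascent y
      ascend zero    B<y Py = ⊥-elim (<⇒≱ B<y (bounded Py))
      ascend (suc n) {y} B< Py with P? (r * y)
      ... | no ¬Pry = 1 , (λ { (s≤s z≤n) → subst P (sym (*-identityˡ y)) Py }) ,
                      (λ Pr¹y → ¬Pry (subst P (cong (_* y) (*-identityʳ r)) Pr¹y))
      ... | yes Pry = raise (ascend n B<′ Pry)
        where
        B<′ : B < n + r * y
        B<′ = <-≤-trans (subst (B <_) (sym (+-suc n y)) B<) (+-monoʳ-≤ n (x<r*x Py))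
        raise : Ascent (r * y) → Ascent y
        raise (ℓ , inside , stop) = suc ℓ , inside′ , λ P-next → stop (subst P (sym (^-shift ℓ y)) P-next)
          where
          inside′ : ∀ {k} → k < suc ℓ → P (r ^ k * y)
          inside′ {zero}  _         = subst P (sym (*-identityˡ y)) Py
          inside′ {suc k} (s<s k<ℓ) = subst P (^-shift k y) (inside k<ℓ)

      maxGeom-through : ∀ {x} → P x → P (r * x) → ∃ λ S → IsMaxGeom r P S × x ∈ S × r * x ∈ S
      maxGeom-through {x} Px Prx with descend x Px
      ... | x₀ , a , x≡ , below , start
        with ascend (suc B) (≤-trans (n<1+n B) (m≤m+n (suc B) x₀)) (subst P (*-identityˡ x₀) (below z≤n))
      ...   | ℓ , inside , stop with suc a <? ℓ
      ...     | no a+1≮ℓ = ⊥-elim (stop (covered (≮⇒≥ a+1≮ℓ)))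
        where
        covered : ∀ {k} → k ≤ suc a → P (r ^ k * x₀)
        covered k≤ with m≤n⇒m<n∨m≡n k≤
        ... | inj₁ (s≤s k≤a) = below k≤a
        ... | inj₂ refl      = subst P (trans (cong (r *_) x≡) (sym (*-assoc r (r ^ a) x₀))) Prx
      ...     | yes a+1<ℓ =
        geom r x₀ ℓ ,
        run⇒isMaxGeom (≤-trans (s≤s (s≤s z≤n)) a+1<ℓ)
          (record { inside = inside ; start = start ; stop = stop }) ,
        subst (_∈ geom r x₀ ℓ) (sym x≡) (∈-geom⁺ x₀ (<-trans (n<1+n a) a+1<ℓ)) ,
        subst (_∈ geom r x₀ ℓ) (trans (*-assoc r (r ^ a) x₀) (cong (r *_) (sym x≡))) (∈-geom⁺ x₀ a+1<ℓ)

-- Chains of a finite set of positive integers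

∈⇒≤sum : ∀ {z} L → z ∈ L → z ≤ sum L
∈⇒≤sum (a ∷ L) (here refl) = m≤m+n a (sum L)
∈⇒≤sum (a ∷ L) (there z∈)  = ≤-trans (∈⇒≤sum L z∈) (m≤n+m (sum L) a)

Isolated : List ℕ → ℕ → Set
Isolated T z = z ∈ T × 2 * z ∉ T × (∀ {w} → z ≡ 2 * w → w ∉ T)

QuadruplesIsolated : List ℕ → Set
QuadruplesIsolated T = ∀ {x} → x ∈ T → 4 * x ∈ T → 2 * x ∉ T → Isolated T x × Isolated T (4 * x)

module Chains (T : List ℕ) (0∉T : 0 ∉ T) where

  private
    module P₂ = Progression 2
    module P₄ = Progression 4

  A-chain-through : ∀ {x} → x ∈ T → 2 * x ∈ T → ∃ λ S → IsChainA T S × x ∈ S × 2 * x ∈ S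
  A-chain-through = P₂.maxGeom-through (InT T) (_∈? T) 0∉T (∈⇒≤sum T)

  isolated⇒remA : ∀ {z} → Isolated T z → RemA T z
  isolated⇒remA (z∈T , 2z∉T , halves∉T) = z∈T , λ (S , chain , z∈S) →
    case P₂.maxGeom-neighbour (InT T) chain z∈S of λ where
      (inj₁ 2z∈T)            → 2z∉T 2z∈T
      (inj₂ (w , z≡2w , w∈T)) → halves∉T z≡2w w∈T

  remA⇒isolated : ∀ {z} → RemA T z → Isolated T z
  remA⇒isolated {z} (z∈T , ∉A) = z∈T , 2z∉T , halves∉T
    where
    2z∉T : 2 * z ∉ T
    2z∉T 2z∈T = let S , chain , z∈S , _ = A-chain-through z∈T 2z∈T in ∉A (S , chain , z∈S)
    halves∉T : ∀ {w} → z ≡ 2 * w → w ∉ T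
    halves∉T refl w∈T = let S , chain , _ , z∈S = A-chain-through w∈T z∈T in ∉A (S , chain , z∈S)

  isolated? : Decidable (Isolated T)
  isolated? z with z ∈? T | 2 * z ∈? T | 2 ∣? z
  ... | no z∉T | _        | _     = no (z∉T ∘ proj₁)
  ... | yes _  | yes 2z∈T | _     = no (λ iso → proj₁ (proj₂ iso) 2z∈T)
  ... | yes z∈T | no 2z∉T | no 2∤z =
    yes (z∈T , 2z∉T , λ {w} z≡2w _ → 2∤z (divides w (trans z≡2w (*-comm 2 w))))
  ... | yes z∈T | no 2z∉T | yes (divides-refl w) with w ∈? T
  ...   | yes w∈T = no (λ iso → proj₂ (proj₂ iso) (*-comm w 2) w∈T)
  ...   | no w∉T  = yes (z∈T , 2z∉T , λ {w′} w*2≡2*w′ →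
                        subst (_∉ T) (*-cancelˡ-≡ w w′ 2 (trans (*-comm 2 w) w*2≡2*w′)) w∉T)

  B-chain-through : ∀ {x} → Isolated T x → Isolated T (4 * x) →
                    ∃ λ S → IsChainB T S × x ∈ S × 4 * x ∈ S
  B-chain-through iso iso₄ =
    P₄.maxGeom-through (RemA T) (λ z → Dec.map′ isolated⇒remA remA⇒isolated (isolated? z))
      (0∉T ∘ proj₁) (∈⇒≤sum T ∘ proj₁) (isolated⇒remA iso) (isolated⇒remA iso₄)

  singleton-chain : ∀ {z} → Isolated T z → 4 * z ∉ T → (∀ {w} → z ≡ 4 * w → w ∉ T) →
                    IsChain T (z ∷ [])
  singleton-chain {z} iso 4z∉T quarters∉T = inj₂ (inj₂ (z , refl , isolated⇒remA iso , ∉B))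
    where
    ∉B : ¬ (∃ λ S → IsChainB T S × z ∈ S)
    ∉B (S , chain , z∈S) with P₄.maxGeom-neighbour (RemA T) chain z∈S
    ... | inj₁ (4z∈T , _)            = 4z∉T 4z∈T
    ... | inj₂ (w , z≡4w , w∈T , _)  = quarters∉T z≡4w w∈T

  chain-nonempty : ∀ {S} → IsChain T S → ∃ λ z → z ∈ S
  chain-nonempty (inj₁ chainA)                  = P₂.maxGeom-nonempty chainA
  chain-nonempty (inj₂ (inj₁ chainB))           = P₄.maxGeom-nonempty chainB
  chain-nonempty (inj₂ (inj₂ (z , refl , _)))   = z , here refl

  chain⊆T : ∀ {S z} → IsChain T S → z ∈ S → z ∈ T
  chain⊆T (inj₁ chainA)                 z∈ = P₂.maxGeom⊆ chainA z∈
  chain⊆T (inj₂ (inj₁ chainB))          z∈ = proj₁ (P₄.maxGeom⊆ chainB z∈)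
  chain⊆T (inj₂ (inj₂ (_ , refl , rem))) (here refl) = proj₁ (proj₁ rem)

  chain-unique : ∀ {S₁ S₂ z} → IsChain T S₁ → IsChain T S₂ → z ∈ S₁ → z ∈ S₂ → S₁ ≡ S₂
  chain-unique (inj₁ a₁) (inj₁ a₂) z∈₁ z∈₂ = P₂.maxGeom-unique (InT T) 0∉T a₁ a₂ z∈₁ z∈₂
  chain-unique (inj₁ a) (inj₂ (inj₁ b)) z∈₁ z∈₂ =
    ⊥-elim (proj₂ (P₄.maxGeom⊆ b z∈₂) (_ , a , z∈₁))
  chain-unique (inj₁ a) (inj₂ (inj₂ (_ , refl , rem))) z∈₁ (here refl) =
    ⊥-elim (proj₂ (proj₁ rem) (_ , a , z∈₁))
  chain-unique (inj₂ (inj₁ b)) (inj₁ a) z∈₁ z∈₂ =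
    ⊥-elim (proj₂ (P₄.maxGeom⊆ b z∈₁) (_ , a , z∈₂))
  chain-unique (inj₂ (inj₁ b₁)) (inj₂ (inj₁ b₂)) z∈₁ z∈₂ =
    P₄.maxGeom-unique (RemA T) (0∉T ∘ proj₁) b₁ b₂ z∈₁ z∈₂
  chain-unique (inj₂ (inj₁ b)) (inj₂ (inj₂ (_ , refl , rem))) z∈₁ (here refl) =
    ⊥-elim (proj₂ rem (_ , b , z∈₁))
  chain-unique (inj₂ (inj₂ (_ , refl , rem))) (inj₁ a) (here refl) z∈₂ =
    ⊥-elim (proj₂ (proj₁ rem) (_ , a , z∈₂))
  chain-unique (inj₂ (inj₂ (_ , refl , rem))) (inj₂ (inj₁ b)) (here refl) z∈₂ =
    ⊥-elim (proj₂ rem (_ , b , z∈₂))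
  chain-unique (inj₂ (inj₂ (_ , refl , _))) (inj₂ (inj₂ (_ , refl , _))) (here refl) (here refl) = refl

  chain-double : ∀ {S₁ S₂ x} → IsChain T S₁ → IsChain T S₂ → x ∈ S₁ → 2 * x ∈ S₂ → S₁ ≡ S₂
  chain-double chain₁ chain₂ x∈₁ 2x∈₂ =
    let S , chainA , x∈S , 2x∈S = A-chain-through (chain⊆T chain₁ x∈₁) (chain⊆T chain₂ 2x∈₂)
    in trans (chain-unique chain₁ (inj₁ chainA) x∈₁ x∈S) (chain-unique (inj₁ chainA) chain₂ 2x∈S 2x∈₂)

  chain-quadruple : QuadruplesIsolated T →
                    ∀ {S₁ S₂ x} → IsChain T S₁ → IsChain T S₂ → x ∈ S₁ → 4 * x ∈ S₂ → S₁ ≡ S₂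
  chain-quadruple isolated {S₂ = S₂} {x} chain₁ chain₂ x∈₁ 4x∈₂ with 2 * x ∈? T
  ... | yes 2x∈T =
    let S , chainA , x∈S , 2x∈S = A-chain-through (chain⊆T chain₁ x∈₁) 2x∈T
    in trans (chain-double chain₁ (inj₁ chainA) x∈₁ 2x∈S)
             (chain-double (inj₁ chainA) chain₂ 2x∈S (subst (_∈ S₂) (*-assoc 2 2 x) 4x∈₂))
  ... | no 2x∉T =
    let iso , iso₄ = isolated (chain⊆T chain₁ x∈₁) (chain⊆T chain₂ 4x∈₂) 2x∉T
        S , chainB , x∈S , 4x∈S = B-chain-through iso iso₄
    in trans (chain-unique chain₁ (inj₂ (inj₁ chainB)) x∈₁ x∈S)
             (chain-unique (inj₂ (inj₁ chainB)) chain₂ 4x∈S 4x∈₂)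

-- The sets H₈^{∇(2ⁿ-1)}

infixl 8 _^⊗_
_^⊗_ : List ℕ → ℕ → List ℕ
A ^⊗ zero  = 1 ∷ []
A ^⊗ suc m = A ^⊗ m ⊗ A

^⊗-+ : ∀ A a b → A ^⊗ (a + b) ≈₂ A ^⊗ a ⊗ A ^⊗ b
^⊗-+ A a zero    =
  subst (λ k → A ^⊗ k ≈₂ A ^⊗ a ⊗ (1 ∷ [])) (sym (+-identityʳ a)) (≈₂-sym (⊗-identityʳ (A ^⊗ a)))
^⊗-+ A a (suc b) = subst (λ k → A ^⊗ k ≈₂ A ^⊗ a ⊗ A ^⊗ suc b) (sym (+-suc a b))
  (≈₂-trans (⊗-congˡ A (^⊗-+ A a b)) (⊗-assoc (A ^⊗ a) (A ^⊗ b) A))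

H8pow-≈₂ : ∀ m → H8pow m ≈₂ H8 ^⊗ m
H8pow-≈₂ zero    = ≈₂-refl
H8pow-≈₂ (suc m) = ≈₂-trans (oddSet-≈₂ (H8pow m ⊗ H8)) (⊗-congˡ H8 (H8pow-≈₂ m))

2^[1+n]∸1 : ∀ n → 2 ^ suc n ∸ 1 ≡ suc ((2 ^ n ∸ 1) + (2 ^ n ∸ 1))
2^[1+n]∸1 n with 2 ^ n | m^n>0 2 n
... | suc k | _ = trans (cong (λ t → suc k + t ∸ 1) (+-identityʳ (suc k))) (+-suc k k)

-- H^{∇(2^{n+1}-1)} = H ∇ (H^{∇(2ⁿ-1)})^{∇2}, and modulo 2 the square of a set is the set of its squares
Tn-suc : ∀ n → Tn (suc n) ≈₂ H8 ⊗ map square (Tn n)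
Tn-suc n = mk≈₂ λ m → begin
  parity m (H8pow (2 ^ suc n ∸ 1))        ≡⟨ cong (parity m ∘ H8pow) (2^[1+n]∸1 n) ⟩
  parity m (H8pow (suc (k + k)))          ≡⟨ parity-≡ (H8pow-≈₂ (suc (k + k))) m ⟩
  parity m (H8 ^⊗ (k + k) ⊗ H8)           ≡⟨ parity-≡ (⊗-congˡ H8 (^⊗-+ H8 k k)) m ⟩
  parity m (H8 ^⊗ k ⊗ H8 ^⊗ k ⊗ H8)        ≡⟨ parity-≡ (⊗-congˡ H8 (⊗-self (H8 ^⊗ k))) m ⟩
  parity m (map square (H8 ^⊗ k) ⊗ H8)    ≡⟨ parity-≡ (⊗-congˡ H8 (map-≈₂ square (H8pow-≈₂ k))) m ⟨
  parity m (map square (H8pow k) ⊗ H8)    ≡⟨ parity-≡ (⊗-comm (map square (H8pow k)) H8) m ⟩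
  parity m (H8 ⊗ map square (Tn n))       ∎
  where
  k : ℕ
  k = 2 ^ n ∸ 1

H8pow-unique : ∀ m → Unique (H8pow m)
H8pow-unique zero    = [] ∷ []
H8pow-unique (suc m) = oddSet-unique (H8pow m ⊗ H8)

0∉H8pow : ∀ m → 0 ∉ H8pow m
0∉H8pow zero    (here ())
0∉H8pow zero    (there ())
0∉H8pow (suc m) 0∈ with ∈-⊗⁻ (H8pow m) H8 (parity≡true⇒∈ _ (Equivalence.to (∈-oddSet⇔ (H8pow m ⊗ H8)) 0∈))
... | a , b , a∈ , b∈ , 0≡ab with m*n≡0⇒m≡0∨n≡0 a (sym 0≡ab)
...   | inj₁ refl = 0∉H8pow m a∈
...   | inj₂ refl = from-no (0 ∈? H8) b∈

0∉Tn : ∀ n → 0 ∉ Tn n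
0∉Tn n = 0∉H8pow (2 ^ n ∸ 1)

-- Square classes

record ScaledSquare (k y : ℕ) : Set where
  constructor scaled
  field
    root      : ℕ
    0<root    : 0 < root
    y≡k*root² : y ≡ k * square root

scaledSquare-disjoint : ∀ p k {l y} {_ : True (prime? p)} {_ : False (p ∣? k)} {_ : False (p ∣? l)} →
                        ScaledSquare (p * k) y → ScaledSquare l y → ⊥
scaledSquare-disjoint p k {l} {y} {p-prime} {p∤k} {p∤l} (scaled s 0<s y≡) (scaled t _ y≡′) =
  p*k*a²≢l*b² (toWitness p-prime) (toWitnessFalse p∤k) (toWitnessFalse p∤l) {b = t} 0<s (trans (sym y≡) y≡′)

scaledSquare-*ˡ : ∀ m {k y} → ScaledSquare k y → ScaledSquare (m * k) (m * y)
scaledSquare-*ˡ m {k} (scaled s 0<s refl) = scaled s 0<s (sym (*-assoc m k (square s)))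

scaledSquare-4* : ∀ {k y} → ScaledSquare k y → ScaledSquare k (4 * y)
scaledSquare-4* {k} (scaled s 0<s refl) = scaled (2 * s) (*-monoʳ-< 2 0<s) (rearrange k s)
  where
  rearrange : ∀ k s → 4 * (k * (s * s)) ≡ k * ((2 * s) * (2 * s))
  rearrange = solve-∀

scaledSquare-2*2 : ∀ {k y} → ScaledSquare (2 * k) y → ScaledSquare k (2 * y)
scaledSquare-2*2 {k} (scaled s 0<s refl) = scaled (2 * s) (*-monoʳ-< 2 0<s) (rearrange k s)
  where
  rearrange : ∀ k s → 2 * (2 * k * (s * s)) ≡ k * ((2 * s) * (2 * s))
  rearrange = solve-∀

Class₁₃ Class₂₆ Class₅₇ Class₁₀₁₄ : ℕ → Set
Class₁₃   y = ScaledSquare 1 y ⊎ ScaledSquare 3 y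
Class₂₆   y = ScaledSquare 2 y ⊎ ScaledSquare 6 y
Class₅₇   y = ScaledSquare 5 y ⊎ ScaledSquare 7 y
Class₁₀₁₄ y = ScaledSquare 10 y ⊎ ScaledSquare 14 y

double-13 : ∀ {y} → Class₁₃ y → Class₂₆ (2 * y)
double-13 = Sum.map (scaledSquare-*ˡ 2) (scaledSquare-*ˡ 2)

double-26 : ∀ {y} → Class₂₆ y → Class₁₃ (2 * y)
double-26 = Sum.map (scaledSquare-2*2 {1}) (scaledSquare-2*2 {3})

double-57 : ∀ {y} → Class₅₇ y → Class₁₀₁₄ (2 * y)
double-57 = Sum.map (scaledSquare-*ˡ 2) (scaledSquare-*ˡ 2)

quadruple-26 : ∀ {y} → Class₂₆ y → Class₂₆ (4 * y)
quadruple-26 = Sum.map scaledSquare-4* scaledSquare-4*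

octuple-57 : ∀ {y} → Class₅₇ y → Class₁₀₁₄ (8 * y)
octuple-57 {y} = subst Class₁₀₁₄ (sym (*-assoc 2 4 y)) ∘ double-57 ∘ Sum.map scaledSquare-4* scaledSquare-4*

disjoint-26-13 : ∀ {y} → Class₂₆ y → Class₁₃ y → ⊥
disjoint-26-13 (inj₁ f) = Sum.[ scaledSquare-disjoint 2 1 f , scaledSquare-disjoint 2 1 f ]
disjoint-26-13 (inj₂ f) = Sum.[ scaledSquare-disjoint 2 3 f , scaledSquare-disjoint 2 3 f ]

disjoint-57-13 : ∀ {y} → Class₅₇ y → Class₁₃ y → ⊥
disjoint-57-13 (inj₁ f) = Sum.[ scaledSquare-disjoint 5 1 f , scaledSquare-disjoint 5 1 f ]
disjoint-57-13 (inj₂ f) = Sum.[ scaledSquare-disjoint 7 1 f , scaledSquare-disjoint 7 1 f ]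

disjoint-57-26 : ∀ {y} → Class₅₇ y → Class₂₆ y → ⊥
disjoint-57-26 (inj₁ f) = Sum.[ scaledSquare-disjoint 5 1 f , scaledSquare-disjoint 5 1 f ]
disjoint-57-26 (inj₂ f) = Sum.[ scaledSquare-disjoint 7 1 f , scaledSquare-disjoint 7 1 f ]

disjoint-1014-57 : ∀ {y} → Class₁₀₁₄ y → Class₅₇ y → ⊥
disjoint-1014-57 (inj₁ f) = Sum.[ scaledSquare-disjoint 2 5 f , scaledSquare-disjoint 2 5 f ]
disjoint-1014-57 (inj₂ f) = Sum.[ scaledSquare-disjoint 2 7 f , scaledSquare-disjoint 2 7 f ]

disjoint-1014-13 : ∀ {y} → Class₁₀₁₄ y → Class₁₃ y → ⊥
disjoint-1014-13 (inj₁ f) = Sum.[ scaledSquare-disjoint 5 2 f , scaledSquare-disjoint 5 2 f ]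
disjoint-1014-13 (inj₂ f) = Sum.[ scaledSquare-disjoint 7 2 f , scaledSquare-disjoint 7 2 f ]

disjoint-1014-26 : ∀ {y} → Class₁₀₁₄ y → Class₂₆ y → ⊥
disjoint-1014-26 (inj₁ f) = Sum.[ scaledSquare-disjoint 5 2 f , scaledSquare-disjoint 5 2 f ]
disjoint-1014-26 (inj₂ f) = Sum.[ scaledSquare-disjoint 7 2 f , scaledSquare-disjoint 7 2 f ]

-- Isolated quadruples in H₈ ∇ R^{∇2}

≡ᵇ-*-cancelˡ : ∀ k .{{_ : NonZero k}} w z → (k * w ≡ᵇ k * z) ≡ (w ≡ᵇ z)
≡ᵇ-*-cancelˡ k w z with w ≡ᵇ z | ≡ᵇ-reflects w z
... | true  | ofʸ refl = ≡ᵇ-refl (k * w)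
... | false | ofⁿ w≢z  = ≢⇒≡ᵇ≡false (w≢z ∘ *-cancelˡ-≡ w z k)

xor-shuffle : ∀ f₁ f₂ f₃ f₄ f₅ f₆ f₇ f₈ →
  f₁ xor (f₂ xor (f₃ xor (f₄ xor (f₅ xor (f₆ xor (f₇ xor (f₈ xor false))))))) ≡
  ((f₁ xor (f₄ xor (f₃ xor false))) xor (f₂ xor (f₈ xor (f₆ xor false)))) xor (f₅ xor (f₇ xor false))
xor-shuffle = solve 8 (λ f₁ f₂ f₃ f₄ f₅ f₆ f₇ f₈ →
  f₁ ⊕ (f₂ ⊕ (f₃ ⊕ (f₄ ⊕ (f₅ ⊕ (f₆ ⊕ (f₇ ⊕ (f₈ ⊕ ε))))))) ⊜
  ((f₁ ⊕ (f₄ ⊕ (f₃ ⊕ ε))) ⊕ (f₂ ⊕ (f₈ ⊕ (f₆ ⊕ ε)))) ⊕ (f₅ ⊕ (f₇ ⊕ ε))) refl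

Classified : ℕ → Set
Classified y = Class₁₃ y ⊎ Class₂₆ y ⊎ Class₅₇ y

half-of-57-unclassified : ∀ {w} → Class₅₇ (2 * w) → ¬ Classified w
half-of-57-unclassified f (inj₁ g)        = disjoint-57-26 f (double-13 g)
half-of-57-unclassified f (inj₂ (inj₁ g)) = disjoint-57-13 f (double-26 g)
half-of-57-unclassified f (inj₂ (inj₂ g)) = disjoint-1014-57 (double-57 g) f

octuple-of-57-unclassified : ∀ {x} → Class₅₇ x → ¬ Classified (8 * x)
octuple-of-57-unclassified f (inj₁ g)        = disjoint-1014-13 (octuple-57 f) g
octuple-of-57-unclassified f (inj₂ (inj₁ g)) = disjoint-1014-26 (octuple-57 f) g
octuple-of-57-unclassified f (inj₂ (inj₂ g)) = disjoint-1014-57 (octuple-57 f) g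

xor₃≡true : ∀ p q r → (p xor q) xor r ≡ true →
            r ≡ true ⊎ (p ≡ true × q ≡ false) ⊎ (p ≡ false × q ≡ true)
xor₃≡true p     q     true  _  = inj₁ refl
xor₃≡true true  false false _  = inj₂ (inj₁ (refl , refl))
xor₃≡true false true  false _  = inj₂ (inj₂ (refl , refl))
xor₃≡true true  true  false ()
xor₃≡true false false false ()

-- H₈ = {1,2}·{1,4,3} + {5,7}, so the elements of H₈ ∇ R^{∇2} fall into the classes 13, 26 = 2·13 and 57.
module H8∇Squares (R : List ℕ) (0∉R : 0 ∉ R) (T : List ℕ) (T! : Unique T) (T≈ : T ≈₂ H8 ⊗ map square R) where

  Q Y Z : List ℕ
  Q = map square R
  Y = (1 ∷ 4 ∷ 3 ∷ []) ⊗ Q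
  Z = (5 ∷ 7 ∷ []) ⊗ Q

  a b c : ℕ → Bool
  a y = parity y Y
  b y = parity y (map (2 *_) Y)
  c y = parity y Z

  parity-T : ∀ y → parity y T ≡ (a y xor b y) xor c y
  parity-T y = begin
    parity y T
      ≡⟨ parity-≡ T≈ y ⟩
    parity y (H8 ⊗ Q)
      ≡⟨ xorSum-⊗ (y ≡ᵇ_) H8 Q ⟩
    F 1 xor (F 2 xor (F 3 xor (F 4 xor (F 5 xor (F 6 xor (F 7 xor (F 8 xor false)))))))
      ≡⟨ xor-shuffle (F 1) (F 2) (F 3) (F 4) (F 5) (F 6) (F 7) (F 8) ⟩
    ((F 1 xor (F 4 xor (F 3 xor false))) xor (F 2 xor (F 8 xor (F 6 xor false)))) xor (F 5 xor (F 7 xor false))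
      ≡⟨ cong₂ _xor_ (cong₂ _xor_ (xorSum-⊗ (y ≡ᵇ_) (1 ∷ 4 ∷ 3 ∷ []) Q) b≡)
                     (xorSum-⊗ (y ≡ᵇ_) (5 ∷ 7 ∷ []) Q) ⟨
    (a y xor b y) xor c y
      ∎
    where
    F : ℕ → Bool
    F h = xorSum (λ q → y ≡ᵇ h * q) Q
    b≡ : b y ≡ F 2 xor (F 8 xor (F 6 xor false))
    b≡ = begin
      b y                                               ≡⟨ xorSum-map (y ≡ᵇ_) (2 *_) Y ⟩
      xorSum (λ z → y ≡ᵇ 2 * z) Y                       ≡⟨ xorSum-⊗ (λ z → y ≡ᵇ 2 * z) (1 ∷ 4 ∷ 3 ∷ []) Q ⟩
      xorSum (λ v → xorSum (λ q → y ≡ᵇ 2 * (v * q)) Q) (1 ∷ 4 ∷ 3 ∷ [])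
        ≡⟨ xorSum-cong (λ v → xorSum-cong (λ q → cong (y ≡ᵇ_) (sym (*-assoc 2 v q))) Q) (1 ∷ 4 ∷ 3 ∷ []) ⟩
      F 2 xor (F 8 xor (F 6 xor false))                 ∎

  b-double : ∀ w → b (2 * w) ≡ a w
  b-double w = trans (xorSum-map (2 * w ≡ᵇ_) (2 *_) Y) (xorSum-cong (≡ᵇ-*-cancelˡ 2 w) Y)

  ∈T⇔ : ∀ {y} → y ∈ T ⇔ (a y xor b y) xor c y ≡ true
  ∈T⇔ {y} = mk⇔ (λ y∈T → trans (sym (parity-T y)) (unique-∈⇒parity≡true T! y∈T))
                         (λ odd → parity≡true⇒∈ T (trans (parity-T y) odd))

  scaledSquare-⊗Q : ∀ {y} K → y ∈ K ⊗ Q → ∃ λ k → k ∈ K × ScaledSquare k y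
  scaledSquare-⊗Q K y∈ with ∈-⊗⁻ K Q y∈
  ... | k , q , k∈K , q∈Q , y≡kq with ∈-map⁻ square q∈Q
  ...   | t , t∈R , refl = k , k∈K , scaled t (n≢0⇒n>0 λ { refl → 0∉R t∈R }) y≡kq

  ∈Y⇒13 : ∀ {y} → y ∈ Y → Class₁₃ y
  ∈Y⇒13 y∈ with scaledSquare-⊗Q (1 ∷ 4 ∷ 3 ∷ []) y∈
  ... | _ , here refl                 , f = inj₁ f
  ... | _ , there (here refl)         , scaled t 0<t refl =
    inj₁ (scaledSquare-4* (scaled t 0<t (sym (*-identityˡ (square t)))))
  ... | _ , there (there (here refl)) , f = inj₂ f

  a⇒13 : ∀ {y} → a y ≡ true → Class₁₃ y
  a⇒13 = ∈Y⇒13 ∘ parity≡true⇒∈ Y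

  b⇒26 : ∀ {y} → b y ≡ true → Class₂₆ y
  b⇒26 {y} odd with ∈-map⁻ (2 *_) (parity≡true⇒∈ {y} (map (2 *_) Y) odd)
  ... | _ , y′∈Y , refl = double-13 (∈Y⇒13 y′∈Y)

  c⇒57 : ∀ {y} → c y ≡ true → Class₅₇ y
  c⇒57 odd with scaledSquare-⊗Q (5 ∷ 7 ∷ []) (parity≡true⇒∈ Z odd)
  ... | _ , here refl         , f = inj₁ f
  ... | _ , there (here refl) , f = inj₂ f

  ∈T⇒cases : ∀ {y} → y ∈ T → c y ≡ true ⊎ (a y ≡ true × b y ≡ false) ⊎ (a y ≡ false × b y ≡ true)
  ∈T⇒cases {y} y∈T = xor₃≡true (a y) (b y) (c y) (Equivalence.to (∈T⇔ {y}) y∈T)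

  ∈T⇒classified : ∀ {y} → y ∈ T → Classified y
  ∈T⇒classified {y} y∈T =
    Sum.[ inj₂ ∘ inj₂ ∘ c⇒57 {y} , Sum.map (a⇒13 {y} ∘ proj₁) (inj₁ ∘ b⇒26 {y} ∘ proj₂) ] (∈T⇒cases y∈T)


  57-isolated : ∀ {x} → Class₅₇ x → (∀ {w} → x ≡ 2 * w → w ∉ T) × 8 * x ∉ T
  57-isolated f = (λ { refl w∈T → half-of-57-unclassified f (∈T⇒classified w∈T) }) ,
                  (λ 8x∈T → octuple-of-57-unclassified f (∈T⇒classified 8x∈T))

  -- the parity of 2x in T is a(2x) ⊕ a(x) ⊕ c(2x), where a(2x) and c(2x) vanish by class
  13⇒2x∈T : ∀ {x} → a x ≡ true → 2 * x ∈ T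
  13⇒2x∈T {x} ax = Equivalence.from (∈T⇔ {2 * x})
    (cong₂ _xor_ (cong₂ _xor_ a2x≡false (trans (b-double x) ax)) c2x≡false)
    where
    26-2x : Class₂₆ (2 * x)
    26-2x = double-13 (a⇒13 {x} ax)
    a2x≡false : a (2 * x) ≡ false
    a2x≡false = ¬-not λ a2x → disjoint-26-13 26-2x (a⇒13 {2 * x} a2x)
    c2x≡false : c (2 * x) ≡ false
    c2x≡false = ¬-not λ c2x → disjoint-57-26 (c⇒57 {2 * x} c2x) 26-2x

  26⇒2x∈T : ∀ {x} → a x ≡ false → b x ≡ true → 4 * x ∈ T → 2 * x ∈ T
  26⇒2x∈T {x} ax bx 4x∈T = Equivalence.from (∈T⇔ {2 * x})
    (cong₂ _xor_ (cong₂ _xor_ a2x≡true (trans (b-double x) ax)) c2x≡false)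
    where
    26-4x : Class₂₆ (4 * x)
    26-4x = quadruple-26 (b⇒26 {x} bx)
    a4x≡false : a (4 * x) ≡ false
    a4x≡false = ¬-not λ a4x → disjoint-26-13 26-4x (a⇒13 {4 * x} a4x)
    c4x≡false : c (4 * x) ≡ false
    c4x≡false = ¬-not λ c4x → disjoint-57-26 (c⇒57 {4 * x} c4x) 26-4x
    b4x≡true : b (4 * x) ≡ true
    b4x≡true = begin
      b (4 * x)                                 ≡⟨ xor-identityʳ (b (4 * x)) ⟨
      (false xor b (4 * x)) xor false
        ≡⟨ cong₂ (λ s t → (s xor b (4 * x)) xor t) a4x≡false c4x≡false ⟨
      (a (4 * x) xor b (4 * x)) xor c (4 * x)   ≡⟨ Equivalence.to (∈T⇔ {4 * x}) 4x∈T ⟩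
      true                                      ∎
    a2x≡true : a (2 * x) ≡ true
    a2x≡true = trans (sym (b-double (2 * x))) (trans (cong b (sym (*-assoc 2 2 x))) b4x≡true)
    c2x≡false : c (2 * x) ≡ false
    c2x≡false = ¬-not λ c2x → disjoint-57-13 (c⇒57 {2 * x} c2x) (double-26 (b⇒26 {x} bx))

  57-unless-double : ∀ {x} → x ∈ T → 4 * x ∈ T → 2 * x ∉ T → Class₅₇ x
  57-unless-double {x} x∈T 4x∈T 2x∉T = by-cases (∈T⇒cases x∈T)
    where
    by-cases : c x ≡ true ⊎ (a x ≡ true × b x ≡ false) ⊎ (a x ≡ false × b x ≡ true) → Class₅₇ x
    by-cases (inj₁ cx)               = c⇒57 {x} cx
    by-cases (inj₂ (inj₁ (ax , _)))  = ⊥-elim (2x∉T (13⇒2x∈T {x} ax))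
    by-cases (inj₂ (inj₂ (ax , bx))) = ⊥-elim (2x∉T (26⇒2x∈T {x} ax bx 4x∈T))

  quadruples-isolated : QuadruplesIsolated T
  quadruples-isolated {x} x∈T 4x∈T 2x∉T =
    let halves∉T , 8x∉T = 57-isolated (57-unless-double x∈T 4x∈T 2x∉T)
    in (x∈T , 2x∉T , halves∉T) ,
       (4x∈T , subst (_∉ T) (*-assoc 2 4 x) 8x∉T , λ {w} 4x≡2w → 2x∉T ∘ subst (_∈ T) (w≡2x 4x≡2w))
    where
    w≡2x : ∀ {w} → 4 * x ≡ 2 * w → w ≡ 2 * x
    w≡2x {w} 4x≡2w = *-cancelˡ-≡ w (2 * x) 2 (trans (sym 4x≡2w) (*-assoc 2 2 x))

Tn-quadruples-isolated : ∀ n → QuadruplesIsolated (Tn n)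
Tn-quadruples-isolated zero    (here refl) (here ())
Tn-quadruples-isolated zero    (here refl) (there ())
Tn-quadruples-isolated (suc n) =
  H8∇Squares.quadruples-isolated (Tn n) (0∉Tn n) (Tn (suc n)) (H8pow-unique (2 ^ suc n ∸ 1)) (Tn-suc n)

-- The chains of T₁ = H₈

stems : List ℕ
stems = 1 ∷ 3 ∷ 5 ∷ 7 ∷ []

span : ℕ → ℕ
span 1 = 4
span 3 = 2
span _ = 1

-- the chain of T₁ whose elements have odd part p
chainOf : ℕ → List ℕ
chainOf p = geom 2 p (span p)

span≤4 : ∀ {p} → p ∈ stems → span p ≤ 4
span≤4 (here refl)                         = ≤-refl
span≤4 (there (here refl))                 = s≤s (s≤s z≤n)
span≤4 (there (there (here refl)))         = s≤s z≤n
span≤4 (there (there (there (here refl)))) = s≤s z≤n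

∈-chainOf⁻ : ∀ {p d} → p ∈ stems → d ∈ chainOf p → ∃ λ e → e ≤ 3 × d ≡ 2 ^ e * p
∈-chainOf⁻ {p} p∈ d∈ =
  let e , e<span , d≡ = Progression.∈-geom⁻ 2 p (span p) d∈ in e , ≤-pred (≤-trans e<span (span≤4 p∈)) , d≡

stem-odd-prime : ∀ {p} → p ∈ stems → 1 < p → Prime p × p ∤ 2
stem-odd-prime (here refl)                         (s≤s ())
stem-odd-prime (there (here refl))                 _ = from-yes (prime? 3) , from-no (3 ∣? 2)
stem-odd-prime (there (there (here refl)))         _ = from-yes (prime? 5) , from-no (5 ∣? 2)
stem-odd-prime (there (there (there (here refl)))) _ = from-yes (prime? 7) , from-no (7 ∣? 2)

module T₁-chains where
  open Chains (Tn 1) (0∉Tn 1)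
  open Progression 2 using (run⇒isMaxGeom; mkRun)

  chainOf-chain : ∀ {p} → p ∈ stems → Chain 1 (chainOf p)
  chainOf-chain (here refl) = inj₁ (run⇒isMaxGeom (InT (Tn 1)) (s≤s (s≤s z≤n))
    (mkRun (InT (Tn 1)) (from-yes (All.all? (_∈? Tn 1) (chainOf 1))) (from-no (2 ∣? 1)) (from-no (16 ∈? Tn 1))))
  chainOf-chain (there (here refl)) = inj₁ (run⇒isMaxGeom (InT (Tn 1)) (s≤s (s≤s z≤n))
    (mkRun (InT (Tn 1)) (from-yes (All.all? (_∈? Tn 1) (chainOf 3))) (from-no (2 ∣? 3)) (from-no (12 ∈? Tn 1))))
  chainOf-chain (there (there (here refl))) =
    singleton-chain (from-yes (isolated? 5)) (from-no (20 ∈? Tn 1))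
    λ {w} 5≡4w _ → from-no (4 ∣? 5) (divides w (trans 5≡4w (*-comm 4 w)))
  chainOf-chain (there (there (there (here refl)))) =
    singleton-chain (from-yes (isolated? 7)) (from-no (28 ∈? Tn 1))
    λ {w} 7≡4w _ → from-no (4 ∣? 7) (divides w (trans 7≡4w (*-comm 4 w)))

  T₁-covered : All (λ d → Any (λ p → d ∈ chainOf p) stems) (Tn 1)
  T₁-covered = from-yes (All.all? (λ d → Any.any? (λ p → d ∈? chainOf p) stems) (Tn 1))

  𝒞₁-classify : ∀ {D} → Chain 1 D → ∃ λ p → p ∈ stems × D ≡ chainOf p
  𝒞₁-classify chain =
    let d , d∈D = chain-nonempty chain
        p , p∈stems , d∈chainOf = find (All.lookup T₁-covered (chain⊆T chain d∈D))
    in p , p∈stems , chain-unique chain (chainOf-chain p∈stems) d∈D d∈chainOf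

open T₁-chains using (𝒞₁-classify)

stem-positive : ∀ {p} → p ∈ stems → 0 < p
stem-positive (here refl)                         = z<s
stem-positive (there (here refl))                 = z<s
stem-positive (there (there (here refl)))         = z<s
stem-positive (there (there (there (here refl)))) = z<s

-- the larger of two distinct stems is an odd prime not dividing the smaller one
larger-stem-separates : ∀ {p q} → p ∈ stems → q ∈ stems → q < p →
                        ∀ {c₁ c₂ e u} → 0 < c₁ → square c₁ * 2 ^ e * p ≢ square c₂ * 2 ^ u * q
larger-stem-separates {p} {q} p∈ q∈ q<p {c₁} {c₂} {e} {u} 0<c₁ =
  let p-prime , p∤2 = stem-odd-prime p∈ (≤-<-trans (stem-positive q∈) q<p)
  in square*2^*p≢square*2^*q p-prime p∤2 p∤q {c₁} {c₂} {e} {u} 0<c₁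
  where
  p∤q : p ∤ q
  p∤q p∣q = <⇒≱ q<p (∣⇒≤ {{>-nonZero (stem-positive q∈)}} p∣q)

stems-separate : ∀ {p₁ p₂ c₁ c₂ e u} → p₁ ∈ stems → p₂ ∈ stems → 0 < c₁ → 0 < c₂ →
                 square c₁ * 2 ^ e * p₁ ≡ square c₂ * 2 ^ u * p₂ → p₁ ≡ p₂
stems-separate {p₁} {p₂} {c₁} {c₂} {e} {u} p₁∈ p₂∈ 0<c₁ 0<c₂ eq with <-cmp p₁ p₂
... | tri< p₁<p₂ _ _ = ⊥-elim (larger-stem-separates p₂∈ p₁∈ p₁<p₂ {c₂} {c₁} {u} {e} 0<c₂ (sym eq))
... | tri≈ _ p₁≡p₂ _ = p₁≡p₂
... | tri> _ _ p₂<p₁ = ⊥-elim (larger-stem-separates p₁∈ p₂∈ p₂<p₁ {c₁} {c₂} {e} {u} 0<c₁ eq)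

∈-[C∇C]∇𝒞₁⁻ : ∀ {m C D} → Chain 1 D → m ∈ (C ∇ C) ∇ D →
               ∃ λ p → p ∈ stems × D ≡ chainOf p × ∃₂ λ c e → c ∈ C × e ≤ 3 × m ≡ square c * 2 ^ e * p
∈-[C∇C]∇𝒞₁⁻ {m} {C} {D} 𝒟 m∈ =
  let p , p∈ , D≡ = 𝒞₁-classify 𝒟
      c , d , c∈ , d∈ , m≡ = ∈-[C∇C]∇D⁻ C D m∈
      e , e≤3 , d≡ = ∈-chainOf⁻ p∈ (subst (d ∈_) D≡ d∈)
  in p , p∈ , D≡ , c , e , c∈ , e≤3 ,
     trans m≡ (trans (cong (square c *_) d≡) (sym (*-assoc (square c) (2 ^ e) p)))

2^i*-absorb : ∀ i c e p → 2 ^ i * (square c * 2 ^ e * p) ≡ square c * 2 ^ (i + e) * p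
2^i*-absorb i c e p = begin
  2 ^ i * (square c * 2 ^ e * p)   ≡⟨ rearrange (2 ^ i) (square c) (2 ^ e) p ⟩
  square c * (2 ^ i * 2 ^ e) * p   ≡⟨ cong (λ x → square c * x * p) (^-distribˡ-+-* 2 i e) ⟨
  square c * 2 ^ (i + e) * p       ∎
  where
  rearrange : ∀ x s y p → x * (s * y * p) ≡ s * (x * y) * p
  rearrange = solve-∀

m+m≤5⇒m≤2 : ∀ {m} → m + m ≤ 5 → m ≤ 2
m+m≤5⇒m≤2 {0} _ = z≤n
m+m≤5⇒m≤2 {1} _ = s≤s z≤n
m+m≤5⇒m≤2 {2} _ = s≤s (s≤s z≤n)
m+m≤5⇒m≤2 {suc (suc (suc m))} (s≤s (s≤s (s≤s m+3+m≤2))) =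
  ⊥-elim (<⇒≱ (s≤s (s≤s (s≤s z≤n))) (≤-trans (m≤n+m (3 + m) m) m+3+m≤2))

module _ (n : ℕ) where
  open Chains (Tn n) (0∉Tn n)

  chain-2^ : ∀ j {S₁ S₂ x} → j ≤ 2 → Chain n S₁ → Chain n S₂ → x ∈ S₁ → 2 ^ j * x ∈ S₂ → S₁ ≡ S₂
  chain-2^ 0 {S₂ = S₂} {x} _ chain₁ chain₂ x∈ x∈′ =
    chain-unique chain₁ chain₂ x∈ (subst (_∈ S₂) (+-identityʳ x) x∈′)
  chain-2^ 1 _ = chain-double
  chain-2^ 2 _ = chain-quadruple (Tn-quadruples-isolated n)
  chain-2^ (suc (suc (suc _))) (s≤s (s≤s ()))

  0<c : ∀ {S c} → Chain n S → c ∈ S → 0 < c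
  0<c chain c∈ = n≢0⇒n>0 λ { refl → 0∉Tn n (chain⊆T chain c∈) }

  same-chain : ∀ {C₁ C₂ c₁ c₂ e u} → Chain n C₁ → Chain n C₂ → c₁ ∈ C₁ → c₂ ∈ C₂ → e ≤ 3 → u ≤ 5 →
               square c₁ * 2 ^ e ≡ square c₂ * 2 ^ u → C₁ ≡ C₂
  same-chain {C₁} {C₂} {c₁} {c₂} {e} {u} chain₁ chain₂ c₁∈ c₂∈ e≤3 u≤5 eq with ≤-total e u
  ... | inj₁ e≤u =
    let j , u≡e+2j , c₁≡2^jc₂ = square*2^-cancel (0<c chain₂ c₂∈) e≤u eq
        j≤2 = m+m≤5⇒m≤2 (≤-trans (m≤n+m (j + j) e) (subst (_≤ 5) u≡e+2j u≤5))
    in sym (chain-2^ j j≤2 chain₂ chain₁ c₂∈ (subst (_∈ C₁) c₁≡2^jc₂ c₁∈))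
  ... | inj₂ u≤e =
    let j , e≡u+2j , c₂≡2^jc₁ = square*2^-cancel (0<c chain₁ c₁∈) u≤e (sym eq)
        j≤2 = m+m≤5⇒m≤2 (≤-trans (m≤n+m (j + j) u) (subst (_≤ 5) e≡u+2j (≤-trans e≤3 (s≤s (s≤s (s≤s z≤n))))))
    in chain-2^ j j≤2 chain₁ chain₂ c₁∈ (subst (_∈ C₂) c₂≡2^jc₁ c₂∈)

  elements-separated : ∀ {C₁ C₂ p₁ p₂ c₁ c₂ e₁ e₂} i → i ≤ 2 → Chain n C₁ → Chain n C₂ →
                       p₁ ∈ stems → p₂ ∈ stems → c₁ ∈ C₁ → c₂ ∈ C₂ → e₁ ≤ 3 → e₂ ≤ 3 →
                       square c₁ * 2 ^ e₁ * p₁ ≡ 2 ^ i * (square c₂ * 2 ^ e₂ * p₂) → C₁ ≡ C₂ × p₁ ≡ p₂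
  elements-separated {p₁ = p₁} {c₂ = c₂} {e₁} {e₂} i i≤2 chain₁ chain₂ p₁∈ p₂∈ c₁∈ c₂∈ e₁≤3 e₂≤3 eq
    with stems-separate {e = e₁} {u = i + e₂} p₁∈ p₂∈ (0<c chain₁ c₁∈) (0<c chain₂ c₂∈)
                        (trans eq (2^i*-absorb i c₂ e₂ _))
  ... | refl = same-chain chain₁ chain₂ c₁∈ c₂∈ e₁≤3 (+-mono-≤ i≤2 e₂≤3)
                 (*-cancelʳ-≡ _ _ p₁ {{>-nonZero (stem-positive p₁∈)}} (trans eq (2^i*-absorb i c₂ e₂ p₁))) ,
               refl

  ∇-disjoint : ∀ {C₁ C₂ D₁ D₂} i → i ≤ 2 → Chain n C₁ → Chain n C₂ → Chain 1 D₁ → Chain 1 D₂ →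
               C₁ ≢ C₂ ⊎ D₁ ≢ D₂ → Disjoint ((C₁ ∇ C₁) ∇ D₁) (scale (2 ^ i) ((C₂ ∇ C₂) ∇ D₂))
  ∇-disjoint i i≤2 chain₁ chain₂ 𝒟₁ 𝒟₂ distinct m∈₁ m∈₂ =
    let y , y∈ , m≡2^iy = ∈-map⁻ (2 ^ i *_) m∈₂
        p₁ , p₁∈ , D₁≡ , c₁ , e₁ , c₁∈ , e₁≤3 , m≡ = ∈-[C∇C]∇𝒞₁⁻ 𝒟₁ m∈₁
        p₂ , p₂∈ , D₂≡ , c₂ , e₂ , c₂∈ , e₂≤3 , y≡ = ∈-[C∇C]∇𝒞₁⁻ 𝒟₂ y∈
        C₁≡C₂ , p₁≡p₂ = elements-separated i i≤2 chain₁ chain₂ p₁∈ p₂∈ c₁∈ c₂∈ e₁≤3 e₂≤3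
                          (trans (sym m≡) (trans m≡2^iy (cong (2 ^ i *_) y≡)))
    in Sum.[ (λ C₁≢C₂ → C₁≢C₂ C₁≡C₂)
           , (λ D₁≢D₂ → D₁≢D₂ (trans D₁≡ (trans (cong chainOf p₁≡p₂) (sym D₂≡)))) ] distinct

proposition5 : (n : ℕ) (C₁ C₂ D₁ D₂ : List ℕ) →
    Chain n C₁ → Chain n C₂ → Chain 1 D₁ → Chain 1 D₂ →
    (C₁ ≢ C₂ ⊎ D₁ ≢ D₂) →
    (i : ℕ) → i ≤ 2 →
    Disjoint ((C₁ ∇ C₁) ∇ D₁) (scale (2 ^ i) ((C₂ ∇ C₂) ∇ D₂)) ×
    Disjoint ((C₂ ∇ C₂) ∇ D₂) (scale (2 ^ i) ((C₁ ∇ C₁) ∇ D₁))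
proposition5 n C₁ C₂ D₁ D₂ chain₁ chain₂ 𝒟₁ 𝒟₂ distinct i i≤2 =
  ∇-disjoint n i i≤2 chain₁ chain₂ 𝒟₁ 𝒟₂ distinct ,
  ∇-disjoint n i i≤2 chain₂ chain₁ 𝒟₂ 𝒟₁ (Sum.map (_∘ sym) (_∘ sym) distinct)
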